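{- Let $m\ge1$, $W=G(m,m,2)$ the dihedral group, with one set of two variables $x,y$, and let $q\in\mathbb{K}$. If $q$ is not of the form $-1/b$ with $b$ an integer, $1\le b\le m$, then $\mathcal{D}_{W,q}=\mathcal{D}_W$, with basis $\{1,x,x^2,\dots,x^{m-1},\,x^m-y^m,\,y^{m-1},\dots,y^2,y\}$. If $q=-1/b$ with $1\le b<m$, a basis of $\mathcal{D}_{W,q}$ is this set together with $x^{b+m}$ and $y^{b+m}$; if $q=-1/m$, a basis is this set together with $x^{2m}-y^{2m}$.
   Context: $\mathbb{K}$ has characteristic zero and contains the needed roots of unity. $G(m,m,2)=\{g\in G(m,2):\det g^{}=1\}$ where $G(m,2)$ is the group of $2\times2$ monomial matrices with $m$-th roots of unity as nonzero entries. For $k\ge1$, $D_{q,k}=(1+q\,x\partial_x)\partial_x^k+(1+q\,y\partial_y)\partial_y^k$. $\mathcal{D}_{W,q}$ is the space of polynomials in $\mathbb{K}[x,y]$ annihilated by $D_{q,k}$ for all positive multiples $k$ of $m$ and by $\partial_x\partial_y$. $\mathcal{D}_W$ is the space of $W$-harmonic polynomials: those $g$ with $f(\partial_x,\partial_y)g=0$ for all $f$ in the ideal generated by constant-term-free $W$-invariant polynomials. -}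

module Defs where

open import Level using (_⊔_)
open import Algebra.Bundles using (CommutativeRing)
open import Data.Nat as ℕ using (ℕ; zero; suc; _∸_; _≤_; _<_)
open import Data.List using (List; []; _∷_; _++_; map; concatMap; foldr; length; upTo)
open import Data.Vec using (Vec; lookup)
import Data.Vec as Vec
open import Data.Fin using (Fin)
open import Data.Product using (_×_; _,_; Σ; ∃; proj₁; proj₂)
open import Data.List.Relation.Unary.All using (All)
open import Relation.Nullary using (¬_)
open import Relation.Binary.PropositionalEquality using (_≡_)

module Poly {c ℓ} (R : CommutativeRing c ℓ) where
  open CommutativeRing R

  fromℕ : ℕ → Carrier
  fromℕ zero = 0#
  fromℕ (suc n) = 1# + fromℕ n

  infixr 8 _^_
  _^_ : Carrier → ℕ → Carrier
  a ^ zero = 1#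
  a ^ suc n = a * (a ^ n)

  IsField : Set (c ⊔ ℓ)
  IsField = (¬ (1# ≈ 0#)) × (∀ a → ¬ (a ≈ 0#) → ∃ λ b → a * b ≈ 1#)

  CharZero : Set ℓ
  CharZero = ∀ n → fromℕ n ≈ 0# → n ≡ 0

  HasPrimitiveRoot : ℕ → Set (c ⊔ ℓ)
  HasPrimitiveRoot m = ∃ λ ζ → (ζ ^ m ≈ 1#) × (∀ k → 0 < k → k < m → ¬ (ζ ^ k ≈ 1#))
    where open import Data.Nat using (_<_)

  -- Polynomials in K[x,y]: a formal finite sum of terms  c·x^i·y^j,
  -- represented by a list of (c , i , j); compared via coefficients.
  Term : Set c
  Term = Carrier × ℕ × ℕ

  Pol : Set c
  Pol = List Term

  coeff : Pol → ℕ → ℕ → Carrier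
  coeff [] i j = 0#
  coeff ((a , k , l) ∷ p) i j with i ℕ.≟ k | j ℕ.≟ l
  ... | Relation.Nullary.yes _ | Relation.Nullary.yes _ = a + coeff p i j
  ... | _ | _ = coeff p i j

  infix 4 _≈P_
  _≈P_ : Pol → Pol → Set ℓ
  p ≈P r = ∀ i j → coeff p i j ≈ coeff r i j

  0P : Pol
  0P = []

  mono : ℕ → ℕ → Pol
  mono i j = (1# , i , j) ∷ []

  infixl 6 _+P_ _-P_
  infixl 7 _*P_ _·P_
  _+P_ : Pol → Pol → Pol
  _+P_ = _++_

  _·P_ : Carrier → Pol → Pol
  a ·P p = map (λ { (b , i , j) → (a * b , i , j) }) p

  _-P_ : Pol → Pol → Pol
  p -P r = p +P ((- 1#) ·P r)

  _*P_ : Pol → Pol → Pol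
  p *P r = concatMap (λ { (a , i , j) → map (λ { (b , k , l) → (a * b , i ℕ.+ k , j ℕ.+ l) }) r }) p

  sumP : List Pol → Pol
  sumP = foldr _+P_ 0P

  ∂x ∂y X Y : Pol → Pol
  ∂x p = map (λ { (a , i , j) → (fromℕ i * a , i ∸ 1 , j) }) p
  ∂y p = map (λ { (a , i , j) → (fromℕ j * a , i , j ∸ 1) }) p
  X p = map (λ { (a , i , j) → (a , suc i , j) }) p
  Y p = map (λ { (a , i , j) → (a , i , suc j) }) p

  iter : (Pol → Pol) → ℕ → Pol → Pol
  iter f zero p = p
  iter f (suc n) p = f (iter f n p)

  applyDiff : Pol → Pol → Pol
  applyDiff f g = concatMap (λ { (a , i , j) → a ·P iter ∂x i (iter ∂y j g) }) f

  Dq : Carrier → ℕ → Pol → Pol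
  Dq q k g = (iter ∂x k g +P q ·P X (∂x (iter ∂x k g)))
           +P (iter ∂y k g +P q ·P Y (∂y (iter ∂y k g)))

  DWq : ℕ → Carrier → Pol → Set ℓ
  DWq m q g = (∀ t → Dq q (suc t ℕ.* m) g ≈P 0P) × (∂x (∂y g) ≈P 0P)

  -- W = G(m,m,2): 2×2 monomial matrices with m-th roots of unity as
  -- nonzero entries whose product is 1:  diag(a,b)  or  [[0,a],[b,0]].
  data Shape : Set where
    diagonal antidiagonal : Shape

  InW : ℕ → Shape → Carrier → Carrier → Set ℓ
  InW m _ a b = (a ^ m ≈ 1#) × (b ^ m ≈ 1#) × (a * b ≈ 1#)

  -- f ↦ f ∘ g  (g·(x,y) = (a x, b y)  resp. (a y, b x))
  act : Shape → Carrier → Carrier → Pol → Pol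
  act diagonal a b f = map (λ { (e , i , j) → (e * (a ^ i) * (b ^ j) , i , j) }) f
  act antidiagonal a b f = map (λ { (e , i , j) → (e * (a ^ i) * (b ^ j) , j , i) }) f

  Invariant : ℕ → Pol → Set (c ⊔ ℓ)
  Invariant m f = ∀ s a b → InW m s a b → act s a b f ≈P f

  InIdeal : ℕ → Pol → Set (c ⊔ ℓ)
  InIdeal m f = Σ (List (Pol × Pol)) λ hs →
      All (λ hu → Invariant m (proj₂ hu) × (coeff (proj₂ hu) 0 0 ≈ 0#)) hs
    × (f ≈P sumP (map (λ hu → proj₁ hu *P proj₂ hu) hs))

  DW : ℕ → Pol → Set (c ⊔ ℓ)
  DW m g = ∀ f → InIdeal m f → applyDiff f g ≈P 0P

  lincomb : (B : List Pol) → Vec Carrier (length B) → Pol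
  lincomb [] _ = 0P
  lincomb (b ∷ B) (a Vec.∷ as) = a ·P b +P lincomb B as

  IsBasis : ∀ {p} → (Pol → Set p) → List Pol → Set (c ⊔ ℓ ⊔ p)
  IsBasis P B = All P B
    × (∀ as → lincomb B as ≈P 0P → ∀ i → lookup as i ≈ 0#)
    × (∀ g → P g → ∃ λ as → g ≈P lincomb B as)

  basisW : ℕ → List Pol
  basisW m = map (λ i → mono i 0) (upTo m)
          ++ (mono m 0 -P mono 0 m) ∷ map (λ i → mono 0 (suc i)) (upTo (m ∸ 1))

  -- q = -1/b  (stated as q·b = -1; b ≠ 0 in characteristic zero)
  IsMinusInv : Carrier → ℕ → Set ℓ
  IsMinusInv q b = q * fromℕ b ≈ - 1#

module Submission where

-- Write c(i,j) for the
-- coefficient of x^i y^j in g; everything is read off coefficients.  ∂x∂y g = 0 kills exactly the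
-- mixed terms, and D_{q,k} scales c(i+k,j) by a positive integer times the weight 1 + q·i.  So
-- g ∈ 𝒟_{W,q} iff c lives on the axes, c(tm,0) + c(0,tm) = 0 and (1 + q·i)·c(i+tm,0) = 0 (and
-- symmetrically) for t, i ≥ 1.  An exponent N > 2m carries two different weights and vanishes; for
-- m < N ≤ 2m only 1 + q(N-m) acts, so c(N,0) survives iff q = -1/(N-m): a Profile with exceptional
-- excesses N - m.  On the harmonic side, invariance under diag(ζ,ζ⁻¹) and the swap gives the ideal
-- no pure powers below degree m and equal x^m, y^m coefficients (IdealShape), so it kills the basis,
-- while the invariants xy and x^m + y^m force harmonic polynomials into the exception-free profile.
-- Bases come from a general criterion for lists in echelon form.

open import Defs
open import Level using (_⊔_)
open import Algebra.Bundles using (CommutativeRing)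
open import Data.Nat as ℕ using (ℕ; zero; suc; z≤n; s≤s)
import Data.Nat.Properties as ℕₚ
open import Data.Nat.Tactic.RingSolver using (solve-∀)
open import Data.List using (List; []; _∷_; _++_; map; upTo)
open import Data.List.Relation.Unary.All as All using (All; []; _∷_)
import Data.List.Relation.Unary.All.Properties as Allₚ
open import Data.List.Relation.Unary.AllPairs as AllPairs using (AllPairs; []; _∷_)
import Data.List.Relation.Unary.AllPairs.Properties as AllPairsₚ
open import Data.List.Relation.Unary.Unique.Propositional.Properties using (upTo⁺)
open import Data.Vec as Vec using (lookup)
import Data.Fin as Fin
open import Data.Product using (_×_; _,_; ∃; proj₁; proj₂)
open import Data.Sum using (_⊎_; inj₁; inj₂)
open import Data.Empty using (⊥)
open import Function using (id)
open import Function.Bundles using (_⇔_; mk⇔)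
open import Relation.Nullary using (¬_; Dec; yes; no; contradiction)
open import Relation.Nullary.Decidable using (_×-dec_)
open import Relation.Binary.PropositionalEquality as ≡ using (_≡_; _≢_)
open import Relation.Binary.Definitions using (tri<; tri≈; tri>)

module Coefficients {c ℓ} (R : CommutativeRing c ℓ) where
  open CommutativeRing R
  open Poly R
  open import Algebra.Properties.Ring ring using (-1*x≈-x)
  open import Algebra.Properties.AbelianGroup +-abelianGroup using (⁻¹-∙-comm)
  open import Algebra.Properties.CommutativeSemigroup +-commutativeSemigroup
    using () renaming (interchange to +-interchange)
  open import Algebra.Properties.CommutativeSemigroup *-commutativeSemigroup
    using () renaming (x∙yz≈y∙xz to *-exchange)
  open import Relation.Binary.Reasoning.Setoid setoid

  +-zero : ∀ {x y} → x ≈ 0# → y ≈ 0# → x + y ≈ 0#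
  +-zero x≈0 y≈0 = trans (+-cong x≈0 y≈0) (+-identityʳ 0#)

  *-zero : ∀ a {x} → x ≈ 0# → a * x ≈ 0#
  *-zero a x≈0 = trans (*-congˡ x≈0) (zeroʳ a)

  vanish-left : ∀ {x y} → x + y ≈ 0# → y ≈ 0# → x ≈ 0#
  vanish-left {x} sum≈0 y≈0 = trans (sym (+-identityʳ x)) (trans (+-congˡ (sym y≈0)) sum≈0)

  vanish-right : ∀ {x y} → x + y ≈ 0# → x ≈ 0# → y ≈ 0#
  vanish-right sum≈0 x≈0 = vanish-left (trans (+-comm _ _) sum≈0) x≈0

  neg-zero : - 0# ≈ 0#
  neg-zero = trans (sym (+-identityˡ _)) (-‿inverseʳ 0#)

  add-sub : ∀ x y → y + (x - y) ≈ x
  add-sub x y = begin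
    y + (x - y)   ≈⟨ +-congˡ (+-comm x (- y)) ⟩
    y + (- y + x) ≈⟨ sym (+-assoc y (- y) x) ⟩
    (y - y) + x   ≈⟨ +-congʳ (-‿inverseʳ y) ⟩
    0# + x        ≈⟨ +-identityˡ x ⟩
    x ∎

  sub-zero : ∀ a {x y} → x ≈ 0# → y ≈ 0# → x - a * y ≈ 0#
  sub-zero a x≈0 y≈0 = trans (+-cong x≈0 (-‿cong (*-zero a y≈0))) (-‿inverseʳ 0#)

  sub-sum-zero : ∀ a {x x' y y'} → x + x' ≈ 0# → y + y' ≈ 0# → (x - a * y) + (x' - a * y') ≈ 0#
  sub-sum-zero a {x} {x'} {y} {y'} xs ys = begin
    (x - a * y) + (x' - a * y')     ≈⟨ +-interchange x (- (a * y)) x' (- (a * y')) ⟩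
    (x + x') + (- (a * y) - a * y') ≈⟨ +-congˡ (⁻¹-∙-comm (a * y) (a * y')) ⟩
    (x + x') - (a * y + a * y')     ≈⟨ +-congˡ (-‿cong (sym (distribˡ a y y'))) ⟩
    (x + x') - a * (y + y')         ≈⟨ sub-zero a xs ys ⟩
    0# ∎

  fromℕ-+ : ∀ a b → fromℕ (a ℕ.+ b) ≈ fromℕ a + fromℕ b
  fromℕ-+ zero b = sym (+-identityˡ _)
  fromℕ-+ (suc a) b = trans (+-congˡ (fromℕ-+ a b)) (sym (+-assoc 1# _ _))

  fromℕ-* : ∀ a b → fromℕ (a ℕ.* b) ≈ fromℕ a * fromℕ b
  fromℕ-* zero b = sym (zeroˡ _)
  fromℕ-* (suc a) b = begin
    fromℕ (b ℕ.+ a ℕ.* b)            ≈⟨ fromℕ-+ b (a ℕ.* b) ⟩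
    fromℕ b + fromℕ (a ℕ.* b)        ≈⟨ +-cong (sym (*-identityˡ _)) (fromℕ-* a b) ⟩
    1# * fromℕ b + fromℕ a * fromℕ b ≈⟨ sym (distribʳ _ 1# _) ⟩
    (1# + fromℕ a) * fromℕ b ∎

  samePoint? : ∀ i j k l → Dec (i ≡ k × j ≡ l)
  samePoint? i j k l = (i ℕ.≟ k) ×-dec (j ℕ.≟ l)

  coeff-hit : ∀ {a k l p i j} → i ≡ k → j ≡ l → coeff ((a , k , l) ∷ p) i j ≈ a + coeff p i j
  coeff-hit {k = k} {l} {i = i} {j} i≡k j≡l with i ℕ.≟ k | j ℕ.≟ l
  ... | yes _ | yes _ = refl
  ... | no i≢k | _ = contradiction i≡k i≢k
  ... | yes _ | no j≢l = contradiction j≡l j≢l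

  coeff-here : ∀ a k l p → coeff ((a , k , l) ∷ p) k l ≈ a + coeff p k l
  coeff-here a k l p = coeff-hit {a} {k} {l} {p} ≡.refl ≡.refl

  coeff-miss : ∀ {a k l p i j} → ¬ (i ≡ k × j ≡ l) → coeff ((a , k , l) ∷ p) i j ≈ coeff p i j
  coeff-miss {k = k} {l} {i = i} {j} ¬same with i ℕ.≟ k | j ℕ.≟ l
  ... | yes i≡k | yes j≡l = contradiction (i≡k , j≡l) ¬same
  ... | no _ | _ = refl
  ... | yes _ | no _ = refl

  coeff-term-cong : ∀ {a b} k l p → a ≈ b → ∀ i j → coeff ((a , k , l) ∷ p) i j ≈ coeff ((b , k , l) ∷ p) i j
  coeff-term-cong k l p a≈b i j with samePoint? i j k l
  ... | yes (i≡k , j≡l) = trans (coeff-hit i≡k j≡l) (trans (+-congʳ a≈b) (sym (coeff-hit i≡k j≡l)))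
  ... | no ¬same = trans (coeff-miss ¬same) (sym (coeff-miss ¬same))

  coeff-cong : ∀ p {i i' j j'} → i ≡ i' → j ≡ j' → coeff p i j ≈ coeff p i' j'
  coeff-cong p i≡i' j≡j' = reflexive (≡.cong₂ (coeff p) i≡i' j≡j')

  coeff-++ : ∀ p r i j → coeff (p +P r) i j ≈ coeff p i j + coeff r i j
  coeff-++ [] r i j = sym (+-identityˡ _)
  coeff-++ ((a , k , l) ∷ p) r i j with samePoint? i j k l
  ... | yes (i≡k , j≡l) = begin
    coeff ((a , k , l) ∷ (p ++ r)) i j    ≈⟨ coeff-hit i≡k j≡l ⟩
    a + coeff (p ++ r) i j                ≈⟨ +-congˡ (coeff-++ p r i j) ⟩
    a + (coeff p i j + coeff r i j)       ≈⟨ sym (+-assoc _ _ _) ⟩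
    (a + coeff p i j) + coeff r i j       ≈⟨ +-congʳ (sym (coeff-hit i≡k j≡l)) ⟩
    coeff ((a , k , l) ∷ p) i j + coeff r i j ∎
  ... | no ¬same = trans (coeff-miss ¬same) (trans (coeff-++ p r i j) (+-congʳ (sym (coeff-miss ¬same))))

  coeff-· : ∀ a p i j → coeff (a ·P p) i j ≈ a * coeff p i j
  coeff-· a [] i j = sym (zeroʳ a)
  coeff-· a ((b , k , l) ∷ p) i j with samePoint? i j k l
  ... | yes (i≡k , j≡l) = begin
    coeff ((a * b , k , l) ∷ (a ·P p)) i j ≈⟨ coeff-hit i≡k j≡l ⟩
    a * b + coeff (a ·P p) i j             ≈⟨ +-congˡ (coeff-· a p i j) ⟩
    a * b + a * coeff p i j                ≈⟨ sym (distribˡ a _ _) ⟩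
    a * (b + coeff p i j)                  ≈⟨ *-congˡ (sym (coeff-hit i≡k j≡l)) ⟩
    a * coeff ((b , k , l) ∷ p) i j ∎
  ... | no ¬same = trans (coeff-miss ¬same) (trans (coeff-· a p i j) (*-congˡ (sym (coeff-miss ¬same))))

  coeff-difference : ∀ p r i j → coeff (p -P r) i j ≈ coeff p i j - coeff r i j
  coeff-difference p r i j =
    trans (coeff-++ p _ i j) (+-congˡ (trans (coeff-· (- 1#) r i j) (-1*x≈-x _)))

  coeff-subtract : ∀ g a b i j → coeff (g -P a ·P b) i j ≈ coeff g i j - a * coeff b i j
  coeff-subtract g a b i j = trans (coeff-difference g (a ·P b) i j) (+-congˡ (-‿cong (coeff-· a b i j)))

  mono-hit : ∀ a b → coeff (mono a b) a b ≈ 1#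
  mono-hit a b = trans (coeff-here 1# a b []) (+-identityʳ 1#)

  mono-miss : ∀ a b i j → ¬ (i ≡ a × j ≡ b) → coeff (mono a b) i j ≈ 0#
  mono-miss a b i j = coeff-miss {1#} {a} {b} {[]} {i} {j}

  coeff-∂x : ∀ p i j → coeff (∂x p) i j ≈ fromℕ (suc i) * coeff p (suc i) j
  coeff-∂x [] i j = sym (zeroʳ _)
  coeff-∂x ((b , zero , l) ∷ p) i j with samePoint? i j 0 l
  ... | yes (i≡0 , j≡l) = trans (coeff-hit i≡0 j≡l) (trans (+-cong (zeroˡ b) (coeff-∂x p i j)) (+-identityˡ _))
  ... | no ¬same = trans (coeff-miss ¬same) (coeff-∂x p i j)
  coeff-∂x ((b , suc k , l) ∷ p) i j with samePoint? i j k l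
  ... | yes (≡.refl , ≡.refl) = begin
    coeff (∂x ((b , suc i , j) ∷ p)) i j                      ≈⟨ coeff-here _ i j (∂x p) ⟩
    fromℕ (suc i) * b + coeff (∂x p) i j                      ≈⟨ +-congˡ (coeff-∂x p i j) ⟩
    fromℕ (suc i) * b + fromℕ (suc i) * coeff p (suc i) j     ≈⟨ sym (distribˡ _ _ _) ⟩
    fromℕ (suc i) * (b + coeff p (suc i) j)                   ≈⟨ *-congˡ (sym (coeff-here b (suc i) j p)) ⟩
    fromℕ (suc i) * coeff ((b , suc i , j) ∷ p) (suc i) j ∎
  ... | no ¬same = trans (coeff-miss ¬same) (trans (coeff-∂x p i j)
                     (*-congˡ (sym (coeff-miss (λ (e , e') → ¬same (ℕₚ.suc-injective e , e'))))))

  coeff-∂y : ∀ p i j → coeff (∂y p) i j ≈ fromℕ (suc j) * coeff p i (suc j)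
  coeff-∂y [] i j = sym (zeroʳ _)
  coeff-∂y ((b , k , zero) ∷ p) i j with samePoint? i j k 0
  ... | yes (i≡k , j≡0) = trans (coeff-hit i≡k j≡0) (trans (+-cong (zeroˡ b) (coeff-∂y p i j))
                            (trans (+-identityˡ _) (*-congˡ (sym (coeff-miss {b} {k} {0} {p} {i} {suc j} (λ ()))))))
  ... | no ¬same = trans (coeff-miss ¬same) (trans (coeff-∂y p i j) (*-congˡ (sym (coeff-miss {b} {k} {0} {p} {i} {suc j} (λ ())))))
  coeff-∂y ((b , k , suc l) ∷ p) i j with samePoint? i j k l
  ... | yes (≡.refl , ≡.refl) = begin
    coeff (∂y ((b , i , suc j) ∷ p)) i j                      ≈⟨ coeff-here _ i j (∂y p) ⟩
    fromℕ (suc j) * b + coeff (∂y p) i j                      ≈⟨ +-congˡ (coeff-∂y p i j) ⟩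
    fromℕ (suc j) * b + fromℕ (suc j) * coeff p i (suc j)     ≈⟨ sym (distribˡ _ _ _) ⟩
    fromℕ (suc j) * (b + coeff p i (suc j))                   ≈⟨ *-congˡ (sym (coeff-here b i (suc j) p)) ⟩
    fromℕ (suc j) * coeff ((b , i , suc j) ∷ p) i (suc j) ∎
  ... | no ¬same = trans (coeff-miss ¬same) (trans (coeff-∂y p i j)
                     (*-congˡ (sym (coeff-miss (λ (e , e') → ¬same (e , ℕₚ.suc-injective e'))))))

  coeff-X : ∀ p i j → coeff (X p) (suc i) j ≈ coeff p i j
  coeff-X [] i j = refl
  coeff-X ((b , k , l) ∷ p) i j with samePoint? i j k l
  ... | yes (i≡k , j≡l) = trans (coeff-hit (≡.cong suc i≡k) j≡l) (trans (+-congˡ (coeff-X p i j)) (sym (coeff-hit i≡k j≡l)))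
  ... | no ¬same = trans (coeff-miss (λ (e , e') → ¬same (ℕₚ.suc-injective e , e'))) (trans (coeff-X p i j) (sym (coeff-miss ¬same)))

  coeff-X-edge : ∀ p j → coeff (X p) 0 j ≈ 0#
  coeff-X-edge [] j = refl
  coeff-X-edge ((b , k , l) ∷ p) j = coeff-X-edge p j

  coeff-Y : ∀ p i j → coeff (Y p) i (suc j) ≈ coeff p i j
  coeff-Y [] i j = refl
  coeff-Y ((b , k , l) ∷ p) i j with samePoint? i j k l
  ... | yes (i≡k , j≡l) = trans (coeff-hit i≡k (≡.cong suc j≡l)) (trans (+-congˡ (coeff-Y p i j)) (sym (coeff-hit i≡k j≡l)))
  ... | no ¬same = trans (coeff-miss (λ (e , e') → ¬same (e , ℕₚ.suc-injective e'))) (trans (coeff-Y p i j) (sym (coeff-miss ¬same)))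

  coeff-Y-edge : ∀ p i → coeff (Y p) i 0 ≈ 0#
  coeff-Y-edge [] i = refl
  coeff-Y-edge ((b , k , l) ∷ p) i = trans (coeff-miss {b} {k} {suc l} {Y p} {i} {0} (λ ())) (coeff-Y-edge p i)

  coeff-X∂x : ∀ p i j → coeff (X (∂x p)) i j ≈ fromℕ i * coeff p i j
  coeff-X∂x p zero j = trans (coeff-X-edge (∂x p) j) (sym (zeroˡ _))
  coeff-X∂x p (suc i) j = trans (coeff-X (∂x p) i j) (coeff-∂x p i j)

  coeff-Y∂y : ∀ p i j → coeff (Y (∂y p)) i j ≈ fromℕ j * coeff p i j
  coeff-Y∂y p i zero = trans (coeff-Y-edge (∂y p) i) (sym (zeroˡ _))
  coeff-Y∂y p i (suc j) = trans (coeff-Y (∂y p) i j) (coeff-∂y p i j)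

  -- falling i k = (i+k)(i+k-1)⋯(i+1): the factor by which ∂ᵏ sends x^(i+k) to x^i.
  falling : ℕ → ℕ → ℕ
  falling i zero = 1
  falling i (suc k) = suc i ℕ.* falling (suc i) k

  -- It is a positive integer, hence invertible in characteristic zero.
  falling-nonzero : ∀ i k → falling i k ≢ 0
  falling-nonzero i zero ()
  falling-nonzero i (suc k) eq with ℕₚ.m*n≡0⇒m≡0∨n≡0 (suc i) eq
  ... | inj₂ eq' = falling-nonzero (suc i) k eq'

  coeff-iter∂x : ∀ k p i j → coeff (iter ∂x k p) i j ≈ fromℕ (falling i k) * coeff p (i ℕ.+ k) j
  coeff-iter∂x zero p i j = begin
    coeff p i j               ≈⟨ sym (*-identityˡ _) ⟩
    1# * coeff p i j          ≈⟨ *-cong (sym (+-identityʳ 1#)) (coeff-cong p (≡.sym (ℕₚ.+-identityʳ i)) ≡.refl) ⟩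
    fromℕ 1 * coeff p (i ℕ.+ 0) j ∎
  coeff-iter∂x (suc k) p i j = begin
    coeff (∂x (iter ∂x k p)) i j                                       ≈⟨ coeff-∂x (iter ∂x k p) i j ⟩
    fromℕ (suc i) * coeff (iter ∂x k p) (suc i) j                      ≈⟨ *-congˡ (coeff-iter∂x k p (suc i) j) ⟩
    fromℕ (suc i) * (fromℕ (falling (suc i) k) * coeff p (suc i ℕ.+ k) j) ≈⟨ sym (*-assoc _ _ _) ⟩
    (fromℕ (suc i) * fromℕ (falling (suc i) k)) * coeff p (suc i ℕ.+ k) j
      ≈⟨ *-cong (sym (fromℕ-* (suc i) (falling (suc i) k))) (coeff-cong p (≡.sym (ℕₚ.+-suc i k)) ≡.refl) ⟩
    fromℕ (falling i (suc k)) * coeff p (i ℕ.+ suc k) j ∎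

  coeff-iter∂y : ∀ k p i j → coeff (iter ∂y k p) i j ≈ fromℕ (falling j k) * coeff p i (j ℕ.+ k)
  coeff-iter∂y zero p i j = begin
    coeff p i j               ≈⟨ sym (*-identityˡ _) ⟩
    1# * coeff p i j          ≈⟨ *-cong (sym (+-identityʳ 1#)) (coeff-cong p ≡.refl (≡.sym (ℕₚ.+-identityʳ j))) ⟩
    fromℕ 1 * coeff p i (j ℕ.+ 0) ∎
  coeff-iter∂y (suc k) p i j = begin
    coeff (∂y (iter ∂y k p)) i j                                       ≈⟨ coeff-∂y (iter ∂y k p) i j ⟩
    fromℕ (suc j) * coeff (iter ∂y k p) i (suc j)                      ≈⟨ *-congˡ (coeff-iter∂y k p i (suc j)) ⟩
    fromℕ (suc j) * (fromℕ (falling (suc j) k) * coeff p i (suc j ℕ.+ k)) ≈⟨ sym (*-assoc _ _ _) ⟩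
    (fromℕ (suc j) * fromℕ (falling (suc j) k)) * coeff p i (suc j ℕ.+ k)
      ≈⟨ *-cong (sym (fromℕ-* (suc j) (falling (suc j) k))) (coeff-cong p ≡.refl (≡.sym (ℕₚ.+-suc j k))) ⟩
    fromℕ (falling j (suc k)) * coeff p i (j ℕ.+ suc k) ∎

  -- weight q n = 1 + q·n is the eigenvalue of 1 + q·x∂x on x^n.
  weight : Carrier → ℕ → Carrier
  weight q n = 1# + q * fromℕ n

  weight-expand : ∀ q n x → x + q * (fromℕ n * x) ≈ weight q n * x
  weight-expand q n x = begin
    x + q * (fromℕ n * x)         ≈⟨ +-cong (sym (*-identityˡ x)) (sym (*-assoc _ _ _)) ⟩
    1# * x + (q * fromℕ n) * x    ≈⟨ sym (distribʳ x _ _) ⟩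
    weight q n * x ∎

  weight-shift : ∀ q a k x → weight q (a ℕ.+ k) * x ≈ weight q a * x + fromℕ k * (q * x)
  weight-shift q a k x = begin
    (1# + q * fromℕ (a ℕ.+ k)) * x                    ≈⟨ *-congʳ (+-congˡ (*-congˡ (fromℕ-+ a k))) ⟩
    (1# + q * (fromℕ a + fromℕ k)) * x                ≈⟨ *-congʳ (+-congˡ (distribˡ q _ _)) ⟩
    (1# + (q * fromℕ a + q * fromℕ k)) * x            ≈⟨ *-congʳ (sym (+-assoc 1# _ _)) ⟩
    (weight q a + q * fromℕ k) * x                    ≈⟨ distribʳ x _ _ ⟩
    weight q a * x + (q * fromℕ k) * x                ≈⟨ +-congˡ (trans (*-assoc q _ x) (*-exchange q _ x)) ⟩
    weight q a * x + fromℕ k * (q * x) ∎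

  weight-zero : ∀ q x → weight q 0 * x ≈ x
  weight-zero q x = trans (*-congʳ (trans (+-congˡ (zeroʳ q)) (+-identityʳ 1#))) (*-identityˡ x)

  coeff-eulerX : ∀ q h i j → coeff (h +P q ·P X (∂x h)) i j ≈ weight q i * coeff h i j
  coeff-eulerX q h i j = begin
    coeff (h +P q ·P X (∂x h)) i j              ≈⟨ coeff-++ h _ i j ⟩
    coeff h i j + coeff (q ·P X (∂x h)) i j     ≈⟨ +-congˡ (trans (coeff-· q (X (∂x h)) i j) (*-congˡ (coeff-X∂x h i j))) ⟩
    coeff h i j + q * (fromℕ i * coeff h i j)   ≈⟨ weight-expand q i _ ⟩
    weight q i * coeff h i j ∎

  coeff-eulerY : ∀ q h i j → coeff (h +P q ·P Y (∂y h)) i j ≈ weight q j * coeff h i j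
  coeff-eulerY q h i j = begin
    coeff (h +P q ·P Y (∂y h)) i j              ≈⟨ coeff-++ h _ i j ⟩
    coeff h i j + coeff (q ·P Y (∂y h)) i j     ≈⟨ +-congˡ (trans (coeff-· q (Y (∂y h)) i j) (*-congˡ (coeff-Y∂y h i j))) ⟩
    coeff h i j + q * (fromℕ j * coeff h i j)   ≈⟨ weight-expand q j _ ⟩
    weight q j * coeff h i j ∎

  coeff-Dq : ∀ q k g i j → coeff (Dq q k g) i j ≈
      weight q i * (fromℕ (falling i k) * coeff g (i ℕ.+ k) j)
    + weight q j * (fromℕ (falling j k) * coeff g i (j ℕ.+ k))
  coeff-Dq q k g i j = begin
    coeff (Dq q k g) i j    ≈⟨ coeff-++ (iter ∂x k g +P q ·P X (∂x (iter ∂x k g))) _ i j ⟩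
    _                       ≈⟨ +-cong (coeff-eulerX q (iter ∂x k g) i j) (coeff-eulerY q (iter ∂y k g) i j) ⟩
    weight q i * coeff (iter ∂x k g) i j + weight q j * coeff (iter ∂y k g) i j
                            ≈⟨ +-cong (*-congˡ (coeff-iter∂x k g i j)) (*-congˡ (coeff-iter∂y k g i j)) ⟩
    _ ∎

  coeff-∂x∂y : ∀ g i j → coeff (∂x (∂y g)) i j ≈ fromℕ (suc i) * (fromℕ (suc j) * coeff g (suc i) (suc j))
  coeff-∂x∂y g i j = trans (coeff-∂x (∂y g) i j) (*-congˡ (coeff-∂y g (suc i) j))

  diffCoeff : Pol → (ℕ → ℕ → Carrier) → ℕ → ℕ → Carrier
  diffCoeff [] c i j = 0#
  diffCoeff ((a , k , l) ∷ f) c i j =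
    a * (fromℕ (falling i k) * (fromℕ (falling j l) * c (i ℕ.+ k) (j ℕ.+ l))) + diffCoeff f c i j

  coeff-applyDiff : ∀ f g i j → coeff (applyDiff f g) i j ≈ diffCoeff f (coeff g) i j
  coeff-applyDiff [] g i j = refl
  coeff-applyDiff ((a , k , l) ∷ f) g i j = begin
    coeff (a ·P iter ∂x k (iter ∂y l g) +P applyDiff f g) i j
      ≈⟨ coeff-++ (a ·P iter ∂x k (iter ∂y l g)) (applyDiff f g) i j ⟩
    coeff (a ·P iter ∂x k (iter ∂y l g)) i j + coeff (applyDiff f g) i j
      ≈⟨ +-cong (coeff-· a (iter ∂x k (iter ∂y l g)) i j) (coeff-applyDiff f g i j) ⟩
    a * coeff (iter ∂x k (iter ∂y l g)) i j + diffCoeff f (coeff g) i j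
      ≈⟨ +-congʳ (*-congˡ (trans (coeff-iter∂x k (iter ∂y l g) i j) (*-congˡ (coeff-iter∂y l g (i ℕ.+ k) j)))) ⟩
    diffCoeff ((a , k , l) ∷ f) (coeff g) i j ∎

  diffCoeff-cong : ∀ f {c c' : ℕ → ℕ → Carrier} → (∀ x y → c x y ≈ c' x y) →
    ∀ i j → diffCoeff f c i j ≈ diffCoeff f c' i j
  diffCoeff-cong [] c≈c' i j = refl
  diffCoeff-cong ((a , k , l) ∷ f) c≈c' i j = +-cong (*-congˡ (*-congˡ (*-congˡ (c≈c' _ _)))) (diffCoeff-cong f c≈c' i j)

  diffCoeff-zero : ∀ f i j → diffCoeff f (λ _ _ → 0#) i j ≈ 0#
  diffCoeff-zero [] i j = refl
  diffCoeff-zero ((a , k , l) ∷ f) i j = +-zero (*-zero a (*-zero _ (*-zero _ refl))) (diffCoeff-zero f i j)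

  diffCoeff-+ : ∀ f (c c' : ℕ → ℕ → Carrier) i j →
    diffCoeff f (λ x y → c x y + c' x y) i j ≈ diffCoeff f c i j + diffCoeff f c' i j
  diffCoeff-+ [] c c' i j = sym (+-identityʳ 0#)
  diffCoeff-+ ((a , k , l) ∷ f) c c' i j = begin
    a * (F * (G * (C + C'))) + diffCoeff f (λ x y → c x y + c' x y) i j
      ≈⟨ +-cong (trans (*-congˡ (trans (*-congˡ (distribˡ G C C')) (distribˡ F _ _))) (distribˡ a _ _)) (diffCoeff-+ f c c' i j) ⟩
    (a * (F * (G * C)) + a * (F * (G * C'))) + (diffCoeff f c i j + diffCoeff f c' i j)
      ≈⟨ +-interchange _ _ _ _ ⟩
    (a * (F * (G * C)) + diffCoeff f c i j) + (a * (F * (G * C')) + diffCoeff f c' i j) ∎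
    where
      F G C C' : Carrier
      F = fromℕ (falling i k)
      G = fromℕ (falling j l)
      C = c (i ℕ.+ k) (j ℕ.+ l)
      C' = c' (i ℕ.+ k) (j ℕ.+ l)

  diffCoeff-* : ∀ f b (c : ℕ → ℕ → Carrier) i j → diffCoeff f (λ x y → b * c x y) i j ≈ b * diffCoeff f c i j
  diffCoeff-* [] b c i j = sym (zeroʳ b)
  diffCoeff-* ((a , k , l) ∷ f) b c i j =
    trans (+-cong (trans (*-congˡ (trans (*-congˡ (*-exchange _ b _)) (*-exchange _ b _))) (*-exchange a b _)) (diffCoeff-* f b c i j))
          (sym (distribˡ b _ _))

  Annihilates : Pol → Pol → Set ℓ
  Annihilates f g = applyDiff f g ≈P 0P

  annihilates-resp : ∀ f {g g'} → g ≈P g' → Annihilates f g' → Annihilates f g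
  annihilates-resp f {g} {g'} g≈g' fg' i j = begin
    coeff (applyDiff f g) i j   ≈⟨ coeff-applyDiff f g i j ⟩
    diffCoeff f (coeff g) i j   ≈⟨ diffCoeff-cong f g≈g' i j ⟩
    diffCoeff f (coeff g') i j  ≈⟨ sym (coeff-applyDiff f g' i j) ⟩
    coeff (applyDiff f g') i j  ≈⟨ fg' i j ⟩
    0# ∎

  annihilates-lincomb : ∀ f B → All (Annihilates f) B → ∀ as → Annihilates f (lincomb B as)
  annihilates-lincomb f [] [] as i j = trans (coeff-applyDiff f [] i j) (diffCoeff-zero f i j)
  annihilates-lincomb f (b ∷ B) (fb ∷ fB) (a Vec.∷ as) i j = begin
    coeff (applyDiff f (a ·P b +P lincomb B as)) i j
      ≈⟨ coeff-applyDiff f _ i j ⟩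
    diffCoeff f (coeff (a ·P b +P lincomb B as)) i j
      ≈⟨ diffCoeff-cong f (λ x y → trans (coeff-++ (a ·P b) _ x y) (+-congʳ (coeff-· a b x y))) i j ⟩
    diffCoeff f (λ x y → a * coeff b x y + coeff (lincomb B as) x y) i j
      ≈⟨ trans (diffCoeff-+ f _ _ i j) (+-congʳ (diffCoeff-* f a (coeff b) i j)) ⟩
    a * diffCoeff f (coeff b) i j + diffCoeff f (coeff (lincomb B as)) i j
      ≈⟨ +-zero (*-zero a (trans (sym (coeff-applyDiff f b i j)) (fb i j)))
                (trans (sym (coeff-applyDiff f _ i j)) (annihilates-lincomb f B fB as i j)) ⟩
    0# ∎

  diffCoeff-mono-inside : ∀ f i j a b →
    diffCoeff f (coeff (mono (i ℕ.+ a) (j ℕ.+ b))) i j ≈ coeff f a b * (fromℕ (falling i a) * fromℕ (falling j b))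
  diffCoeff-mono-inside [] i j a b = sym (zeroˡ _)
  diffCoeff-mono-inside ((e , k , l) ∷ f) i j a b with samePoint? a b k l
  ... | yes (≡.refl , ≡.refl) = begin
    e * (F * (G * coeff (mono (i ℕ.+ a) (j ℕ.+ b)) (i ℕ.+ a) (j ℕ.+ b))) + diffCoeff f _ i j
      ≈⟨ +-cong (*-congˡ (*-congˡ (trans (*-congˡ (mono-hit (i ℕ.+ a) (j ℕ.+ b))) (*-identityʳ G))))
                (diffCoeff-mono-inside f i j a b) ⟩
    e * (F * G) + coeff f a b * (F * G)      ≈⟨ sym (distribʳ _ e _) ⟩
    (e + coeff f a b) * (F * G)              ≈⟨ *-congʳ (sym (coeff-here e a b f)) ⟩
    coeff ((e , a , b) ∷ f) a b * (F * G) ∎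
    where
      F G : Carrier
      F = fromℕ (falling i a)
      G = fromℕ (falling j b)
  ... | no ¬same = trans (+-cong (*-zero e (*-zero _ (*-zero _ (mono-miss (i ℕ.+ a) (j ℕ.+ b) (i ℕ.+ k) (j ℕ.+ l) shifted))))
                                 (diffCoeff-mono-inside f i j a b))
                         (trans (+-identityˡ _) (*-congʳ (sym (coeff-miss ¬same))))
    where
      shifted : ¬ (i ℕ.+ k ≡ i ℕ.+ a × j ℕ.+ l ≡ j ℕ.+ b)
      shifted (e₁ , e₂) = ¬same (≡.sym (ℕₚ.+-cancelˡ-≡ i k a e₁) , ≡.sym (ℕₚ.+-cancelˡ-≡ j l b e₂))

  beyond-shift : ∀ {A B i j} k l → A ℕ.< i ⊎ B ℕ.< j → ¬ (i ℕ.+ k ≡ A × j ℕ.+ l ≡ B)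
  beyond-shift {i = i} k l (inj₁ A<i) (e , _) = ℕₚ.<⇒≱ A<i (ℕₚ.≤-trans (ℕₚ.m≤m+n i k) (ℕₚ.≤-reflexive e))
  beyond-shift {j = j} k l (inj₂ B<j) (_ , e) = ℕₚ.<⇒≱ B<j (ℕₚ.≤-trans (ℕₚ.m≤m+n j l) (ℕₚ.≤-reflexive e))

  diffCoeff-mono-outside : ∀ f {A B} i j → A ℕ.< i ⊎ B ℕ.< j → diffCoeff f (coeff (mono A B)) i j ≈ 0#
  diffCoeff-mono-outside [] i j out = refl
  diffCoeff-mono-outside ((e , k , l) ∷ f) i j out =
    +-zero (*-zero e (*-zero _ (*-zero _ (mono-miss _ _ (i ℕ.+ k) (j ℕ.+ l) (beyond-shift k l out))))) (diffCoeff-mono-outside f i j out)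

  coeff-shift-inside : ∀ a s t u p r → coeff (((a , s , t) ∷ []) *P u) (s ℕ.+ p) (t ℕ.+ r) ≈ a * coeff u p r
  coeff-shift-inside a s t [] p r = sym (zeroʳ a)
  coeff-shift-inside a s t ((b , k , l) ∷ u) p r with samePoint? p r k l
  ... | yes (≡.refl , ≡.refl) = begin
    coeff (((a , s , t) ∷ []) *P ((b , p , r) ∷ u)) (s ℕ.+ p) (t ℕ.+ r)
      ≈⟨ coeff-here (a * b) (s ℕ.+ p) (t ℕ.+ r) (((a , s , t) ∷ []) *P u) ⟩
    a * b + coeff (((a , s , t) ∷ []) *P u) (s ℕ.+ p) (t ℕ.+ r) ≈⟨ +-congˡ (coeff-shift-inside a s t u p r) ⟩
    a * b + a * coeff u p r                                     ≈⟨ sym (distribˡ a b _) ⟩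
    a * (b + coeff u p r)                                       ≈⟨ *-congˡ (sym (coeff-here b p r u)) ⟩
    a * coeff ((b , p , r) ∷ u) p r ∎
  ... | no ¬same = trans (coeff-miss (λ (e₁ , e₂) → ¬same (ℕₚ.+-cancelˡ-≡ s p k e₁ , ℕₚ.+-cancelˡ-≡ t r l e₂)))
                         (trans (coeff-shift-inside a s t u p r) (*-congˡ (sym (coeff-miss ¬same))))

  coeff-shift-outside : ∀ a s t u {i j} → i ℕ.< s ⊎ j ℕ.< t → coeff (((a , s , t) ∷ []) *P u) i j ≈ 0#
  coeff-shift-outside a s t [] out = refl
  coeff-shift-outside a s t ((b , k , l) ∷ u) {i} {j} out =
    trans (coeff-miss {a * b} {s ℕ.+ k} {t ℕ.+ l} {((a , s , t) ∷ []) *P u} {i} {j}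
                      (λ (e₁ , e₂) → beyond-shift k l out (≡.sym e₁ , ≡.sym e₂)))
          (coeff-shift-outside a s t u out)

  coeff-*P-cons : ∀ t h u i j → coeff ((t ∷ h) *P u) i j ≈ coeff ((t ∷ []) *P u) i j + coeff (h *P u) i j
  coeff-*P-cons (a , s , t) h u i j = begin
    coeff (shifted ++ (h *P u)) i j       ≈⟨ coeff-++ shifted (h *P u) i j ⟩
    coeff shifted i j + coeff (h *P u) i j ≈⟨ +-congʳ (sym (trans (coeff-++ shifted [] i j) (+-identityʳ _))) ⟩
    coeff (shifted ++ []) i j + coeff (h *P u) i j ∎
    where
      shifted : Pol
      shifted = map (λ { (b , k , l) → (a * b , s ℕ.+ k , t ℕ.+ l) }) u

  ^-cong : ∀ {x y} n → x ≈ y → x ^ n ≈ y ^ n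
  ^-cong zero x≈y = refl
  ^-cong (suc n) x≈y = *-cong x≈y (^-cong n x≈y)

  1^ : ∀ n → 1# ^ n ≈ 1#
  1^ zero = refl
  1^ (suc n) = trans (*-identityˡ _) (1^ n)

  ^-distrib-* : ∀ x y n → (x * y) ^ n ≈ x ^ n * y ^ n
  ^-distrib-* x y zero = sym (*-identityˡ 1#)
  ^-distrib-* x y (suc n) = begin
    (x * y) * (x * y) ^ n      ≈⟨ *-congˡ (^-distrib-* x y n) ⟩
    (x * y) * (x ^ n * y ^ n)  ≈⟨ *-assoc x y _ ⟩
    x * (y * (x ^ n * y ^ n))  ≈⟨ *-congˡ (*-exchange y _ _) ⟩
    x * (x ^ n * (y * y ^ n))  ≈⟨ sym (*-assoc x _ _) ⟩
    (x * x ^ n) * (y * y ^ n) ∎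

  inverse-root : ∀ {a b} n → a * b ≈ 1# → a ^ n ≈ 1# → b ^ n ≈ 1#
  inverse-root {a} {b} n ab≈1 aⁿ≈1 = begin
    b ^ n           ≈⟨ sym (*-identityʳ _) ⟩
    b ^ n * 1#      ≈⟨ *-congˡ (sym aⁿ≈1) ⟩
    b ^ n * a ^ n   ≈⟨ sym (^-distrib-* b a n) ⟩
    (b * a) ^ n     ≈⟨ ^-cong n (trans (*-comm b a) ab≈1) ⟩
    1# ^ n          ≈⟨ 1^ n ⟩
    1# ∎

  coeff-act-diagonal : ∀ a b u i j → coeff (act diagonal a b u) i j ≈ (coeff u i j * a ^ i) * b ^ j
  coeff-act-diagonal a b [] i j = sym (trans (*-congʳ (zeroˡ _)) (zeroˡ _))
  coeff-act-diagonal a b ((e , k , l) ∷ u) i j with samePoint? i j k l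
  ... | yes (≡.refl , ≡.refl) = begin
    coeff (act diagonal a b ((e , i , j) ∷ u)) i j ≈⟨ coeff-here _ i j (act diagonal a b u) ⟩
    e * a ^ i * b ^ j + coeff (act diagonal a b u) i j ≈⟨ +-congˡ (coeff-act-diagonal a b u i j) ⟩
    e * a ^ i * b ^ j + (coeff u i j * a ^ i) * b ^ j  ≈⟨ sym (distribʳ _ _ _) ⟩
    (e * a ^ i + coeff u i j * a ^ i) * b ^ j          ≈⟨ *-congʳ (sym (distribʳ _ _ _)) ⟩
    ((e + coeff u i j) * a ^ i) * b ^ j                ≈⟨ *-congʳ (*-congʳ (sym (coeff-here e i j u))) ⟩
    (coeff ((e , i , j) ∷ u) i j * a ^ i) * b ^ j ∎
  ... | no ¬same = trans (coeff-miss ¬same) (trans (coeff-act-diagonal a b u i j) (*-congʳ (*-congʳ (sym (coeff-miss ¬same)))))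

  coeff-act-antidiagonal : ∀ a b u i j → coeff (act antidiagonal a b u) i j ≈ (coeff u j i * a ^ j) * b ^ i
  coeff-act-antidiagonal a b [] i j = sym (trans (*-congʳ (zeroˡ _)) (zeroˡ _))
  coeff-act-antidiagonal a b ((e , k , l) ∷ u) i j with samePoint? j i k l
  ... | yes (≡.refl , ≡.refl) = begin
    coeff (act antidiagonal a b ((e , j , i) ∷ u)) i j ≈⟨ coeff-here _ i j (act antidiagonal a b u) ⟩
    e * a ^ j * b ^ i + coeff (act antidiagonal a b u) i j ≈⟨ +-congˡ (coeff-act-antidiagonal a b u i j) ⟩
    e * a ^ j * b ^ i + (coeff u j i * a ^ j) * b ^ i      ≈⟨ sym (distribʳ _ _ _) ⟩
    (e * a ^ j + coeff u j i * a ^ j) * b ^ i              ≈⟨ *-congʳ (sym (distribʳ _ _ _)) ⟩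
    ((e + coeff u j i) * a ^ j) * b ^ i                    ≈⟨ *-congʳ (*-congʳ (sym (coeff-here e j i u))) ⟩
    (coeff ((e , j , i) ∷ u) j i * a ^ j) * b ^ i ∎
  ... | no ¬same = trans (coeff-miss (λ (e₁ , e₂) → ¬same (e₂ , e₁)))
                         (trans (coeff-act-antidiagonal a b u i j) (*-congʳ (*-congʳ (sym (coeff-miss ¬same)))))

  pivot : Pol → ℕ × ℕ
  pivot [] = (0 , 0)
  pivot ((_ , i , j) ∷ _) = (i , j)

  coeffAt : Pol → ℕ × ℕ → Carrier
  coeffAt p x = coeff p (proj₁ x) (proj₂ x)

  Echelon : List Pol → Set (c ⊔ ℓ)
  Echelon B = All (λ b → coeffAt b (pivot b) ≈ 1#) B × AllPairs (λ b b' → coeffAt b' (pivot b) ≈ 0#) B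

  VanishesOnPivots : Pol → List Pol → Set (c ⊔ ℓ)
  VanishesOnPivots g B = All (λ b → coeffAt g (pivot b) ≈ 0#) B

  -- Closure under g ↦ g - a·b, the only operation needed for elimination.
  SubtractionClosed : ∀ {p} → (Pol → Set p) → Set (c ⊔ p)
  SubtractionClosed P = ∀ {g b} a → P g → P b → P (g -P a ·P b)

  coeff-lincomb-cons : ∀ b B a as i j → coeff (lincomb (b ∷ B) (a Vec.∷ as)) i j ≈ a * coeff b i j + coeff (lincomb B as) i j
  coeff-lincomb-cons b B a as i j = trans (coeff-++ (a ·P b) (lincomb B as) i j) (+-congʳ (coeff-· a b i j))

  lincomb-vanishes : ∀ B x → All (λ b → coeffAt b x ≈ 0#) B → ∀ as → coeffAt (lincomb B as) x ≈ 0#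
  lincomb-vanishes [] x [] as = refl
  lincomb-vanishes (b ∷ B) x (b₀ ∷ B₀) (a Vec.∷ as) =
    trans (coeff-lincomb-cons b B a as _ _) (+-zero (*-zero a b₀) (lincomb-vanishes B x B₀ as))

  -- Reading off the coefficient at the first pivot shows that an echelon list is linearly independent.
  echelon-independent : ∀ B → Echelon B → ∀ as → lincomb B as ≈P 0P → ∀ k → lookup as k ≈ 0#
  echelon-independent (b ∷ B) (b₁ ∷ ones , later ∷ pairs) (a Vec.∷ as) comb≈0 = λ where
      Fin.zero → a≈0
      (Fin.suc k) → echelon-independent B (ones , pairs) as rest≈0 k
    where
      a≈0 : a ≈ 0#
      a≈0 = begin
        a                                                  ≈⟨ sym (*-identityʳ a) ⟩
        a * 1#                                             ≈⟨ *-congˡ (sym b₁) ⟩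
        a * coeffAt b (pivot b)                            ≈⟨ sym (+-identityʳ _) ⟩
        a * coeffAt b (pivot b) + 0#                       ≈⟨ +-congˡ (sym (lincomb-vanishes B (pivot b) later as)) ⟩
        a * coeffAt b (pivot b) + coeffAt (lincomb B as) (pivot b) ≈⟨ sym (coeff-lincomb-cons b B a as _ _) ⟩
        coeffAt (lincomb (b ∷ B) (a Vec.∷ as)) (pivot b)   ≈⟨ comb≈0 _ _ ⟩
        0# ∎
      rest≈0 : lincomb B as ≈P 0P
      rest≈0 i j = begin
        coeff (lincomb B as) i j                     ≈⟨ sym (+-identityˡ _) ⟩
        0# + coeff (lincomb B as) i j                ≈⟨ +-congʳ (sym (trans (*-congʳ a≈0) (zeroˡ _))) ⟩
        a * coeff b i j + coeff (lincomb B as) i j   ≈⟨ sym (coeff-lincomb-cons b B a as i j) ⟩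
        coeff (lincomb (b ∷ B) (a Vec.∷ as)) i j     ≈⟨ comb≈0 i j ⟩
        0# ∎

  -- Spanning by elimination: subtract the right multiple of the first member, so that the
  -- remainder vanishes at its pivot, and recurse inside the subspace of such polynomials.
  -- The hypothesis on P says that a member of P is determined by its coefficients at the pivots.
  echelon-spans : ∀ {p} (P : Pol → Set p) → SubtractionClosed P → ∀ B → Echelon B → All P B →
    (∀ g → P g → VanishesOnPivots g B → g ≈P 0P) → ∀ g → P g → ∃ λ as → g ≈P lincomb B as
  echelon-spans P closed [] _ [] determined g pg = Vec.[] , determined g pg []
  echelon-spans P closed (b ∷ B) (b₁ ∷ ones , later ∷ pairs) (pb ∷ pB) determined g pg =
    (a Vec.∷ proj₁ remainder) , recombine
    where
      a : Carrier
      a = coeffAt g (pivot b)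
      h : Pol
      h = g -P a ·P b

      P₀ : Pol → Set _
      P₀ x = P x × coeffAt x (pivot b) ≈ 0#

      closed₀ : SubtractionClosed P₀
      closed₀ {x} {y} e (px , x₀) (py , y₀) = closed e px py , trans (coeff-subtract x e y _ _) (sub-zero e x₀ y₀)

      h₀ : coeffAt h (pivot b) ≈ 0#
      h₀ = trans (coeff-subtract g a b _ _) (trans (+-congˡ (-‿cong (trans (*-congˡ b₁) (*-identityʳ a)))) (-‿inverseʳ a))

      remainder : ∃ λ as → h ≈P lincomb B as
      remainder = echelon-spans P₀ closed₀ B (ones , pairs) (All.zip (pB , later))
        (λ x (px , x₀) vanish → determined x px (x₀ ∷ vanish)) h (closed a pg pb , h₀)

      recombine : g ≈P lincomb (b ∷ B) (a Vec.∷ proj₁ remainder)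
      recombine i j = begin
        coeff g i j                                        ≈⟨ sym (add-sub _ _) ⟩
        a * coeff b i j + (coeff g i j - a * coeff b i j)  ≈⟨ +-congˡ (sym (coeff-subtract g a b i j)) ⟩
        a * coeff b i j + coeff h i j                      ≈⟨ +-congˡ (proj₂ remainder i j) ⟩
        a * coeff b i j + coeff (lincomb B _) i j          ≈⟨ sym (coeff-lincomb-cons b B a _ i j) ⟩
        coeff (lincomb (b ∷ B) (a Vec.∷ proj₁ remainder)) i j ∎

  echelon-basis : ∀ {p q} (P : Pol → Set p) (Q : Pol → Set q) → SubtractionClosed P → (∀ {g} → Q g → P g) →
    ∀ B → Echelon B → All Q B → (∀ g → P g → VanishesOnPivots g B → g ≈P 0P) → IsBasis Q B
  echelon-basis P Q closed Q⊆P B echelon qB determined =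
    qB , echelon-independent B echelon ,
    λ g qg → echelon-spans P closed B echelon (All.map Q⊆P qB) determined g (Q⊆P qg)

  echelon-++ : ∀ {B C} → Echelon B → Echelon C → All (λ b → All (λ b' → coeffAt b' (pivot b) ≈ 0#) C) B →
    Echelon (B ++ C)
  echelon-++ (onesB , pairsB) (onesC , pairsC) cross = Allₚ.++⁺ onesB onesC , AllPairsₚ.++⁺ pairsB pairsC cross

  echelon-family : ∀ (f : ℕ → Pol) n → (∀ k → coeffAt (f k) (pivot (f k)) ≈ 1#) →
    (∀ {k l} → k ≢ l → coeffAt (f l) (pivot (f k)) ≈ 0#) → Echelon (map f (upTo n))
  echelon-family f n ones separated =
    Allₚ.map⁺ (Allₚ.applyUpTo⁺₂ id n ones) , AllPairsₚ.map⁺ (AllPairs.map separated (upTo⁺ n))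

module Dihedral {c ℓ} (R : CommutativeRing c ℓ) (m' : ℕ) where
  open CommutativeRing R
  open Poly R
  open Coefficients R
  open import Algebra.Properties.Ring ring using (-1*x≈-x)
  open import Algebra.Properties.CommutativeSemigroup *-commutativeSemigroup
    using () renaming (x∙yz≈y∙xz to *-exchange)
  open import Relation.Binary.Reasoning.Setoid setoid

  m : ℕ
  m = suc m'

  data Position (N : ℕ) : Set where
    below : N ℕ.< m → Position N
    at    : N ≡ m → Position N
    above : ∀ n → N ≡ suc n ℕ.+ m → Position N

  position : ∀ N → Position N
  position N with ℕₚ.<-cmp N m
  ... | tri< N<m _ _ = below N<m
  ... | tri≈ _ N≡m _ = at N≡m
  ... | tri> _ _ m<N = above (N ℕ.∸ suc m) (≡.sym (≡.trans (≡.sym (ℕₚ.+-suc (N ℕ.∸ suc m) m)) (ℕₚ.m∸n+n≡m m<N)))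

  -- The first multiple suc 0 * m of m computes to m + 0.
  m+0≡m : m ℕ.+ 0 ≡ m
  m+0≡m = ℕₚ.+-identityʳ m

  -- The second multiple 2 * m computes to m + (m + 0).
  2m≡m+m : 2 ℕ.* m ≡ m ℕ.+ m
  2m≡m+m = ≡.cong (m ℕ.+_) m+0≡m

  -- The coefficient profile shared by all the spaces of the theorem.  E is a set of exceptional
  -- excesses e ≥ 1: only for e ∈ E may the coefficients of x^(e+m) and y^(e+m) be nonzero.

  record Profile (E : ℕ → Set) (g : Pol) : Set ℓ where
    field
      mixed    : ∀ i j → coeff g (suc i) (suc j) ≈ 0#
      balanced : ∀ t → coeff g (suc t ℕ.* m) 0 + coeff g 0 (suc t ℕ.* m) ≈ 0#
      beyondX  : ∀ n → ¬ E (suc n) → coeff g (suc n ℕ.+ m) 0 ≈ 0#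
      beyondY  : ∀ n → ¬ E (suc n) → coeff g 0 (suc n ℕ.+ m) ≈ 0#

    balanced-m : coeff g m 0 + coeff g 0 m ≈ 0#
    balanced-m = trans (+-cong (coeff-cong g (≡.sym m+0≡m) ≡.refl) (coeff-cong g ≡.refl (≡.sym m+0≡m))) (balanced 0)

  NoExceptions : ℕ → Set
  NoExceptions _ = ⊥

  profile-closed : ∀ E → SubtractionClosed (Profile E)
  profile-closed E {g} {b} a pg pb = record
    { mixed    = λ i j → subtracted (mixed pg i j) (mixed pb i j)
    ; balanced = λ t → trans (+-cong (coeff-subtract g a b _ 0) (coeff-subtract g a b 0 _))
                             (sub-sum-zero a (balanced pg t) (balanced pb t))
    ; beyondX  = λ n ¬e → subtracted (beyondX pg n ¬e) (beyondX pb n ¬e)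
    ; beyondY  = λ n ¬e → subtracted (beyondY pg n ¬e) (beyondY pb n ¬e)
    }
    where
      open Profile
      subtracted : ∀ {i j} → coeff g i j ≈ 0# → coeff b i j ≈ 0# → coeff (g -P a ·P b) i j ≈ 0#
      subtracted g₀ b₀ = trans (coeff-subtract g a b _ _) (sub-zero a g₀ b₀)

  profile-weaken : ∀ {E E' g} → (∀ {e} → E e → E' e) → Profile E g → Profile E' g
  profile-weaken E⊆E' pg = record
    { mixed = mixed ; balanced = balanced
    ; beyondX = λ n ¬e → beyondX n (λ e → ¬e (E⊆E' e))
    ; beyondY = λ n ¬e → beyondY n (λ e → ¬e (E⊆E' e)) }
    where open Profile pg

  profile-determined : ∀ {E g} → (∀ e → Dec (E e)) → Profile E g →
    (∀ k → k ℕ.< m → coeff g k 0 ≈ 0#) → coeff g m 0 ≈ 0# → (∀ k → k ℕ.< m' → coeff g 0 (suc k) ≈ 0#) →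
    (∀ n → E (suc n) → coeff g (suc n ℕ.+ m) 0 ≈ 0# × coeff g 0 (suc n ℕ.+ m) ≈ 0#) → g ≈P 0P
  profile-determined {E} {g} E? pg lowX topX lowY exceptional = pointwise
    where
      open Profile pg
      axisX : ∀ N → coeff g N 0 ≈ 0#
      axisX N with position N
      ... | below N<m = lowX N N<m
      ... | at ≡.refl = topX
      ... | above n ≡.refl with E? (suc n)
      ...   | yes e = proj₁ (exceptional n e)
      ...   | no ¬e = beyondX n ¬e
      axisY : ∀ N → coeff g 0 (suc N) ≈ 0#
      axisY N with position (suc N)
      ... | below N<m = lowY N (ℕₚ.≤-pred N<m)
      ... | at ≡.refl = trans (sym (+-identityˡ _)) (trans (+-congʳ (sym topX)) balanced-m)
      ... | above n ≡.refl with E? (suc n)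
      ...   | yes e = proj₂ (exceptional n e)
      ...   | no ¬e = beyondY n ¬e
      pointwise : g ≈P 0P
      pointwise i zero = axisX i
      pointwise zero (suc j) = axisY j
      pointwise (suc i) (suc j) = mixed i j

  axisDifference : ℕ → Pol
  axisDifference a = mono a 0 -P mono 0 a

  difference-pivot : ∀ a → coeff (axisDifference (suc a)) (suc a) 0 ≈ 1#
  difference-pivot a = begin
    coeff (axisDifference (suc a)) (suc a) 0                       ≈⟨ coeff-difference (mono (suc a) 0) _ (suc a) 0 ⟩
    coeff (mono (suc a) 0) (suc a) 0 - coeff (mono 0 (suc a)) (suc a) 0
      ≈⟨ +-cong (mono-hit (suc a) 0) (-‿cong (mono-miss 0 (suc a) (suc a) 0 (λ ()))) ⟩
    1# - 0#                                                        ≈⟨ trans (+-congˡ neg-zero) (+-identityʳ 1#) ⟩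
    1# ∎

  difference-off : ∀ a i j → ¬ (i ≡ a × j ≡ 0) → ¬ (i ≡ 0 × j ≡ a) → coeff (axisDifference a) i j ≈ 0#
  difference-off a i j offX offY =
    trans (coeff-difference (mono a 0) (mono 0 a) i j)
          (trans (+-cong (mono-miss a 0 i j offX) (-‿cong (mono-miss 0 a i j offY))) (-‿inverseʳ 0#))

  difference-balanced : ∀ a n → coeff (axisDifference a) (suc n) 0 + coeff (axisDifference a) 0 (suc n) ≈ 0#
  difference-balanced a n = balance a (suc n ℕ.≟ a)
    where
      balance : ∀ a → Dec (suc n ≡ a) → coeff (axisDifference a) (suc n) 0 + coeff (axisDifference a) 0 (suc n) ≈ 0#
      balance a (no n≢a) = +-zero (difference-off a (suc n) 0 (λ (e , _) → n≢a e) (λ ()))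
                                  (difference-off a 0 (suc n) (λ ()) (λ (_ , e) → n≢a e))
      balance _ (yes ≡.refl) = begin
        coeff (axisDifference (suc n)) (suc n) 0 + coeff (axisDifference (suc n)) 0 (suc n)
          ≈⟨ +-cong (difference-pivot n) (coeff-difference (mono (suc n) 0) (mono 0 (suc n)) 0 (suc n)) ⟩
        1# + (coeff (mono (suc n) 0) 0 (suc n) - coeff (mono 0 (suc n)) 0 (suc n))
          ≈⟨ +-congˡ (+-cong (mono-miss (suc n) 0 0 (suc n) (λ ())) (-‿cong (mono-hit 0 (suc n)))) ⟩
        1# + (0# - 1#)  ≈⟨ +-congˡ (+-identityˡ (- 1#)) ⟩
        1# - 1#         ≈⟨ -‿inverseʳ 1# ⟩
        0# ∎

  below≢ : ∀ {k N} → k ℕ.< m → m ℕ.≤ N → N ≢ k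
  below≢ k<m m≤N N≡k = ℕₚ.<⇒≱ k<m (ℕₚ.≤-trans m≤N (ℕₚ.≤-reflexive N≡k))

  excess≢m : ∀ n → suc n ℕ.+ m ≢ m
  excess≢m n e = ℕₚ.m≢1+n+m m (≡.sym e)

  multiple≥m : ∀ t → m ℕ.≤ suc t ℕ.* m
  multiple≥m t = ℕₚ.m≤m+n m (t ℕ.* m)

  excess≥m : ∀ n → m ℕ.≤ suc n ℕ.+ m
  excess≥m n = ℕₚ.m≤n+m m (suc n)

  xPower-profile : ∀ k → k ℕ.< m → Profile NoExceptions (mono k 0)
  xPower-profile k k<m = record
    { mixed    = λ i j → mono-miss k 0 (suc i) (suc j) (λ ())
    ; balanced = λ t → +-zero (mono-miss k 0 (suc t ℕ.* m) 0 (λ (e , _) → below≢ k<m (multiple≥m t) e))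
                              (mono-miss k 0 0 (suc t ℕ.* m) (λ ()))
    ; beyondX  = λ n _ → mono-miss k 0 (suc n ℕ.+ m) 0 (λ (e , _) → below≢ k<m (excess≥m n) e)
    ; beyondY  = λ n _ → mono-miss k 0 0 (suc n ℕ.+ m) (λ ())
    }

  yPower-profile : ∀ k → k ℕ.< m → Profile NoExceptions (mono 0 k)
  yPower-profile k k<m = record
    { mixed    = λ i j → mono-miss 0 k (suc i) (suc j) (λ ())
    ; balanced = λ t → +-zero (mono-miss 0 k (suc t ℕ.* m) 0 (λ ()))
                              (mono-miss 0 k 0 (suc t ℕ.* m) (λ (_ , e) → below≢ k<m (multiple≥m t) e))
    ; beyondX  = λ n _ → mono-miss 0 k (suc n ℕ.+ m) 0 (λ ())
    ; beyondY  = λ n _ → mono-miss 0 k 0 (suc n ℕ.+ m) (λ (_ , e) → below≢ k<m (excess≥m n) e)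
    }

  top-profile : Profile NoExceptions (axisDifference m)
  top-profile = record
    { mixed    = λ i j → difference-off m (suc i) (suc j) (λ ()) (λ ())
    ; balanced = λ t → difference-balanced m (m' ℕ.+ t ℕ.* m)
    ; beyondX  = λ n _ → difference-off m (suc n ℕ.+ m) 0 (λ (e , _) → excess≢m n e) (λ ())
    ; beyondY  = λ n _ → difference-off m 0 (suc n ℕ.+ m) (λ ()) (λ (_ , e) → excess≢m n e)
    }

  basis-profile : All (Profile NoExceptions) (basisW m)
  basis-profile = Allₚ.++⁺ (Allₚ.map⁺ (Allₚ.applyUpTo⁺₁ id m (xPower-profile _)))
                           (top-profile ∷ Allₚ.map⁺ (Allₚ.applyUpTo⁺₁ id m' (λ k<m' → yPower-profile _ (s≤s k<m'))))

  basis-echelon : Echelon (basisW m)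
  basis-echelon = echelon-++ xPowers topFirst cross
    where
      xPowers : Echelon (map (λ i → mono i 0) (upTo m))
      xPowers = echelon-family (λ i → mono i 0) m (λ k → mono-hit k 0) (λ {k} {l} k≢l → mono-miss l 0 k 0 (λ (e , _) → k≢l e))
      yPowers : Echelon (map (λ i → mono 0 (suc i)) (upTo m'))
      yPowers = echelon-family (λ i → mono 0 (suc i)) m' (λ k → mono-hit 0 (suc k))
                               (λ {k} {l} k≢l → mono-miss 0 (suc l) 0 (suc k) (λ (_ , e) → k≢l (ℕₚ.suc-injective e)))
      topFirst : Echelon (axisDifference m ∷ map (λ i → mono 0 (suc i)) (upTo m'))
      topFirst = (difference-pivot m' ∷ proj₁ yPowers) ,
                 (Allₚ.map⁺ (Allₚ.applyUpTo⁺₂ id m' (λ k → mono-miss 0 (suc k) m 0 (λ ()))) ∷ proj₂ yPowers)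
      cross : All (λ b → All (λ b' → coeffAt b' (pivot b) ≈ 0#) (axisDifference m ∷ map (λ i → mono 0 (suc i)) (upTo m')))
                  (map (λ i → mono i 0) (upTo m))
      cross = Allₚ.map⁺ (Allₚ.applyUpTo⁺₁ id m (λ {k} k<m →
                difference-off m k 0 (λ (e , _) → ℕₚ.<⇒≢ k<m e) (λ ()) ∷
                Allₚ.map⁺ (Allₚ.applyUpTo⁺₂ id m' (λ l → mono-miss 0 (suc l) k 0 (λ ())))))

  basis-pivots : ∀ {g} → VanishesOnPivots g (basisW m) →
    (∀ k → k ℕ.< m → coeff g k 0 ≈ 0#) × coeff g m 0 ≈ 0# × (∀ k → k ℕ.< m' → coeff g 0 (suc k) ≈ 0#)
  basis-pivots v with Allₚ.++⁻ (map (λ i → mono i 0) (upTo m)) v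
  ... | xs , t ∷ ys = (λ k → Allₚ.applyUpTo⁻ id m (Allₚ.map⁻ xs)) , t , (λ k → Allₚ.applyUpTo⁻ id m' (Allₚ.map⁻ ys))

  VanishesOnBox : Pol → Set ℓ
  VanishesOnBox p = ∀ i j → i ℕ.≤ m → j ℕ.≤ m → coeff p i j ≈ 0#

  basis-pivots-in-box : All (λ b → proj₁ (pivot b) ℕ.≤ m × proj₂ (pivot b) ℕ.≤ m) (basisW m)
  basis-pivots-in-box = Allₚ.++⁺ (Allₚ.map⁺ (Allₚ.applyUpTo⁺₁ id m (λ k<m → ℕₚ.<⇒≤ k<m , z≤n)))
    ((ℕₚ.≤-refl , z≤n) ∷ Allₚ.map⁺ (Allₚ.applyUpTo⁺₁ id m' (λ k<m' → z≤n , ℕₚ.m≤n⇒m≤1+n k<m')))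

  echelon-extension : ∀ {C} → Echelon C → All VanishesOnBox C → Echelon (basisW m ++ C)
  echelon-extension echelonC boxC = echelon-++ basis-echelon echelonC
    (All.map (λ (i≤m , j≤m) → All.map (λ v → v _ _ i≤m j≤m) boxC) basis-pivots-in-box)

  -- Elements of the ideal generated by the invariants without constant term have no pure
  -- powers of degree < m and equal coefficients at x^m and y^m.

  record IdealShape (f : Pol) : Set ℓ where
    field
      lowX      : ∀ k → k ℕ.< m → coeff f k 0 ≈ 0#
      lowY      : ∀ k → k ℕ.< m → coeff f 0 k ≈ 0#
      symmetric : coeff f m 0 ≈ coeff f 0 m

  shape-empty : IdealShape []
  shape-empty = record { lowX = λ _ _ → refl ; lowY = λ _ _ → refl ; symmetric = refl }

  shape-split : ∀ {F A B} → (∀ i j → coeff F i j ≈ coeff A i j + coeff B i j) →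
    IdealShape A → IdealShape B → IdealShape F
  shape-split split sA sB = record
    { lowX      = λ k k<m → trans (split k 0) (+-zero (lowX sA k k<m) (lowX sB k k<m))
    ; lowY      = λ k k<m → trans (split 0 k) (+-zero (lowY sA k k<m) (lowY sB k k<m))
    ; symmetric = trans (split m 0) (trans (+-cong (symmetric sA) (symmetric sB)) (sym (split 0 m)))
    }
    where open IdealShape

  shape-resp : ∀ {F A} → F ≈P A → IdealShape A → IdealShape F
  shape-resp F≈A sA = shape-split (λ i j → trans (F≈A i j) (sym (+-identityʳ _))) sA shape-empty

  shift-axisX : ∀ a s t u → IdealShape u → ∀ k → k ℕ.< s ℕ.+ m → coeff (((a , s , t) ∷ []) *P u) k 0 ≈ 0#
  shift-axisX a s (suc t) u su k _ = coeff-shift-outside a s (suc t) u (inj₂ (s≤s z≤n))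
  shift-axisX a s zero u su k k<s+m with s ℕ.≤? k
  ... | no s≰k = coeff-shift-outside a s 0 u (inj₁ (ℕₚ.≰⇒> s≰k))
  ... | yes s≤k = begin
    coeff (((a , s , 0) ∷ []) *P u) k 0
      ≈⟨ coeff-cong (((a , s , 0) ∷ []) *P u) (≡.sym (ℕₚ.m+[n∸m]≡n s≤k)) ≡.refl ⟩
    coeff (((a , s , 0) ∷ []) *P u) (s ℕ.+ (k ℕ.∸ s)) 0   ≈⟨ coeff-shift-inside a s 0 u (k ℕ.∸ s) 0 ⟩
    a * coeff u (k ℕ.∸ s) 0
      ≈⟨ *-zero a (IdealShape.lowX su (k ℕ.∸ s) (ℕₚ.m<n+o⇒m∸n<o k s k<s+m)) ⟩
    0# ∎

  shift-axisY : ∀ a s t u → IdealShape u → ∀ k → k ℕ.< t ℕ.+ m → coeff (((a , s , t) ∷ []) *P u) 0 k ≈ 0#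
  shift-axisY a (suc s) t u su k _ = coeff-shift-outside a (suc s) t u (inj₁ (s≤s z≤n))
  shift-axisY a zero t u su k k<t+m with t ℕ.≤? k
  ... | no t≰k = coeff-shift-outside a 0 t u (inj₂ (ℕₚ.≰⇒> t≰k))
  ... | yes t≤k = begin
    coeff (((a , 0 , t) ∷ []) *P u) 0 k
      ≈⟨ coeff-cong (((a , 0 , t) ∷ []) *P u) ≡.refl (≡.sym (ℕₚ.m+[n∸m]≡n t≤k)) ⟩
    coeff (((a , 0 , t) ∷ []) *P u) 0 (t ℕ.+ (k ℕ.∸ t))   ≈⟨ coeff-shift-inside a 0 t u 0 (k ℕ.∸ t) ⟩
    a * coeff u 0 (k ℕ.∸ t)
      ≈⟨ *-zero a (IdealShape.lowY su (k ℕ.∸ t) (ℕₚ.m<n+o⇒m∸n<o k t k<t+m)) ⟩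
    0# ∎

  -- Multiplying by a single term preserves the shape: only the constant term of the multiplier can reach x^m and y^m.
  shape-shift : ∀ a s t u → IdealShape u → IdealShape (((a , s , t) ∷ []) *P u)
  shape-shift a s t u su = record
    { lowX      = λ k k<m → shift-axisX a s t u su k (ℕₚ.<-≤-trans k<m (ℕₚ.m≤n+m m s))
    ; lowY      = λ k k<m → shift-axisY a s t u su k (ℕₚ.<-≤-trans k<m (ℕₚ.m≤n+m m t))
    ; symmetric = symmetric′ s t
    }
    where
      symmetric′ : ∀ s t → coeff (((a , s , t) ∷ []) *P u) m 0 ≈ coeff (((a , s , t) ∷ []) *P u) 0 m
      symmetric′ zero zero = trans (coeff-shift-inside a 0 0 u m 0)
        (trans (*-congˡ (IdealShape.symmetric su)) (sym (coeff-shift-inside a 0 0 u 0 m)))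
      symmetric′ (suc s) t = trans (shift-axisX a (suc s) t u su m (ℕₚ.m<n+m m (s≤s z≤n)))
        (sym (coeff-shift-outside a (suc s) t u (inj₁ (s≤s z≤n))))
      symmetric′ zero (suc t) = trans (coeff-shift-outside a 0 (suc t) u (inj₂ (s≤s z≤n)))
        (sym (shift-axisY a 0 (suc t) u su m (ℕₚ.m<n+m m (s≤s z≤n))))

  shape-product : ∀ h u → IdealShape u → IdealShape (h *P u)
  shape-product [] u su = shape-empty
  shape-product (term ∷ h) u su = shape-split (coeff-*P-cons term h u)
    (shape-shift (proj₁ term) (proj₁ (proj₂ term)) (proj₂ (proj₂ term)) u su) (shape-product h u su)

  diffCoeff-xPower : ∀ f N i j → (∀ a → i ℕ.+ a ≡ N → j ≡ 0 → coeff f a 0 ≈ 0#) →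
    diffCoeff f (coeff (mono N 0)) i j ≈ 0#
  diffCoeff-xPower f N i (suc j) _ = diffCoeff-mono-outside f i (suc j) (inj₂ (s≤s z≤n))
  diffCoeff-xPower f N i zero vanish with i ℕ.≤? N
  ... | no i≰N = diffCoeff-mono-outside f i 0 (inj₁ (ℕₚ.≰⇒> i≰N))
  ... | yes i≤N = ≡.subst (λ A → diffCoeff f (coeff (mono A 0)) i 0 ≈ 0#) (ℕₚ.m+[n∸m]≡n i≤N)
    (trans (diffCoeff-mono-inside f i 0 (N ℕ.∸ i) 0) (trans (*-congʳ (vanish _ (ℕₚ.m+[n∸m]≡n i≤N) ≡.refl)) (zeroˡ _)))

  diffCoeff-yPower : ∀ f N i j → (∀ b → i ≡ 0 → j ℕ.+ b ≡ N → coeff f 0 b ≈ 0#) →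
    diffCoeff f (coeff (mono 0 N)) i j ≈ 0#
  diffCoeff-yPower f N (suc i) j _ = diffCoeff-mono-outside f (suc i) j (inj₁ (s≤s z≤n))
  diffCoeff-yPower f N zero j vanish with j ℕ.≤? N
  ... | no j≰N = diffCoeff-mono-outside f 0 j (inj₂ (ℕₚ.≰⇒> j≰N))
  ... | yes j≤N = ≡.subst (λ B → diffCoeff f (coeff (mono 0 B)) 0 j ≈ 0#) (ℕₚ.m+[n∸m]≡n j≤N)
    (trans (diffCoeff-mono-inside f 0 j 0 (N ℕ.∸ j)) (trans (*-congʳ (vanish _ ≡.refl (ℕₚ.m+[n∸m]≡n j≤N))) (zeroˡ _)))

  summand<m : ∀ {i a N} → i ℕ.+ a ≡ N → N ℕ.< m ⊎ (N ≡ m × 0 ℕ.< i) → a ℕ.< m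
  summand<m {i} {a} i+a≡N (inj₁ N<m) = ℕₚ.≤-<-trans (ℕₚ.≤-trans (ℕₚ.m≤n+m a i) (ℕₚ.≤-reflexive i+a≡N)) N<m
  summand<m {i} {a} i+a≡N (inj₂ (≡.refl , 0<i)) = ℕₚ.<-≤-trans (ℕₚ.m<n+m a 0<i) (ℕₚ.≤-reflexive i+a≡N)

  shape-annihilates-xPower : ∀ {f} → IdealShape f → ∀ n → n ℕ.< m → Annihilates f (mono n 0)
  shape-annihilates-xPower {f} sf n n<m i j = trans (coeff-applyDiff f (mono n 0) i j)
    (diffCoeff-xPower f n i j (λ a i+a≡n _ → IdealShape.lowX sf a (summand<m i+a≡n (inj₁ n<m))))

  shape-annihilates-yPower : ∀ {f} → IdealShape f → ∀ n → n ℕ.< m → Annihilates f (mono 0 n)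
  shape-annihilates-yPower {f} sf n n<m i j = trans (coeff-applyDiff f (mono 0 n) i j)
    (diffCoeff-yPower f n i j (λ b _ j+b≡n → IdealShape.lowY sf b (summand<m j+b≡n (inj₁ n<m))))

  -- On x^m - y^m the two top contributions cancel because f is symmetric in degree m.
  shape-annihilates-top : ∀ {f} → IdealShape f → Annihilates f (axisDifference m)
  shape-annihilates-top {f} sf i j = begin
    coeff (applyDiff f (axisDifference m)) i j
      ≈⟨ coeff-applyDiff f _ i j ⟩
    diffCoeff f (coeff (axisDifference m)) i j
      ≈⟨ diffCoeff-cong f (λ x y → trans (coeff-++ (mono m 0) _ x y) (+-congˡ (coeff-· (- 1#) (mono 0 m) x y))) i j ⟩
    diffCoeff f (λ x y → coeff (mono m 0) x y + - 1# * coeff (mono 0 m) x y) i j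
      ≈⟨ trans (diffCoeff-+ f _ _ i j) (+-congˡ (diffCoeff-* f (- 1#) (coeff (mono 0 m)) i j)) ⟩
    diffCoeff f (coeff (mono m 0)) i j + - 1# * diffCoeff f (coeff (mono 0 m)) i j
      ≈⟨ cancel i j ⟩
    0# ∎
    where
      open IdealShape sf
      cancel : ∀ i j → diffCoeff f (coeff (mono m 0)) i j + - 1# * diffCoeff f (coeff (mono 0 m)) i j ≈ 0#
      cancel zero zero = begin
        diffCoeff f (coeff (mono m 0)) 0 0 + - 1# * diffCoeff f (coeff (mono 0 m)) 0 0
          ≈⟨ +-cong (diffCoeff-mono-inside f 0 0 m 0) (*-congˡ (diffCoeff-mono-inside f 0 0 0 m)) ⟩
        coeff f m 0 * (A * B) + - 1# * (coeff f 0 m * (B * A))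
          ≈⟨ +-congˡ (trans (-1*x≈-x _) (-‿cong (*-cong (sym symmetric) (*-comm B A)))) ⟩
        coeff f m 0 * (A * B) - coeff f m 0 * (A * B)
          ≈⟨ -‿inverseʳ _ ⟩
        0# ∎
        where
          A B : Carrier
          A = fromℕ (falling 0 m)
          B = fromℕ (falling 0 0)
      cancel (suc i) j = +-zero
        (diffCoeff-xPower f m (suc i) j (λ a e _ → lowX a (summand<m e (inj₂ (≡.refl , s≤s z≤n)))))
        (*-zero _ (diffCoeff-yPower f m (suc i) j (λ _ ())))
      cancel zero (suc j) = +-zero
        (diffCoeff-xPower f m 0 (suc j) (λ _ _ ()))
        (*-zero _ (diffCoeff-yPower f m 0 (suc j) (λ b _ e → lowY b (summand<m e (inj₂ (≡.refl , s≤s z≤n))))))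

  basis-determined : ∀ {E g} → (∀ e → Dec (E e)) → Profile E g → VanishesOnPivots g (basisW m) →
    (∀ n → E (suc n) → coeff g (suc n ℕ.+ m) 0 ≈ 0# × coeff g 0 (suc n ℕ.+ m) ≈ 0#) → g ≈P 0P
  basis-determined {g = g} E? pg vanish exceptional with basis-pivots {g} vanish
  ... | lowX , topX , lowY = profile-determined E? pg lowX topX lowY exceptional

  module WithField (isField : IsField) (charZero : CharZero) (root : HasPrimitiveRoot m) where
    open import Algebra.Properties.Group +-group using (x∙y⁻¹≈ε⇒x≈y)

    cancel : ∀ {a x} → ¬ (a ≈ 0#) → a * x ≈ 0# → x ≈ 0#
    cancel {a} {x} a≉0 ax≈0 with proj₂ isField a a≉0
    ... | b , ab≈1 = begin
      x             ≈⟨ sym (*-identityˡ x) ⟩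
      1# * x        ≈⟨ *-congʳ (sym (trans (*-comm b a) ab≈1)) ⟩
      (b * a) * x   ≈⟨ *-assoc b a x ⟩
      b * (a * x)   ≈⟨ *-zero b ax≈0 ⟩
      0# ∎

    cancel-fromℕ : ∀ n {x} → n ≢ 0 → fromℕ n * x ≈ 0# → x ≈ 0#
    cancel-fromℕ n n≢0 = cancel (λ n≈0 → n≢0 (charZero n n≈0))

    cancel-falling : ∀ i k {x} → fromℕ (falling i k) * x ≈ 0# → x ≈ 0#
    cancel-falling i k = cancel-fromℕ (falling i k) (falling-nonzero i k)

    fixed-by-nontrivial : ∀ {c z} → ¬ (z ≈ 1#) → c * z ≈ c → c ≈ 0#
    fixed-by-nontrivial {c} {z} z≉1 cz≈c = cancel (λ z-1≈0 → z≉1 (x∙y⁻¹≈ε⇒x≈y z 1# z-1≈0)) (begin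
      (z - 1#) * c          ≈⟨ distribʳ c z (- 1#) ⟩
      z * c + - 1# * c      ≈⟨ +-cong (trans (*-comm z c) cz≈c) (-1*x≈-x c) ⟩
      c - c                 ≈⟨ -‿inverseʳ c ⟩
      0# ∎)

    ζ ζ⁻¹ : Carrier
    ζ = proj₁ root
    ζ⁻¹ = ζ ^ m'

    ζᵐ≈1 : ζ ^ m ≈ 1#
    ζᵐ≈1 = proj₁ (proj₂ root)

    ζ⁻¹ᵐ≈1 : ζ⁻¹ ^ m ≈ 1#
    ζ⁻¹ᵐ≈1 = inverse-root m ζᵐ≈1 ζᵐ≈1

    ζ-primitive : ∀ k → suc k ℕ.< m → ¬ (ζ ^ suc k ≈ 1#)
    ζ-primitive k = proj₂ (proj₂ root) (suc k) (s≤s z≤n)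

    -- diag(ζ , ζ⁻¹) kills the pure powers of degree < m; the swap (x , y) ↦ (y , x) symmetrises degree m.
    invariant-shape : ∀ {u} → Invariant m u → coeff u 0 0 ≈ 0# → IdealShape u
    invariant-shape {u} invariant u₀₀ = record { lowX = lowX ; lowY = lowY ; symmetric = symmetric }
      where
        lowX : ∀ k → k ℕ.< m → coeff u k 0 ≈ 0#
        lowX zero _ = u₀₀
        lowX (suc k) k<m = fixed-by-nontrivial (ζ-primitive k k<m) (begin
          coeff u (suc k) 0 * ζ ^ suc k                ≈⟨ sym (*-identityʳ _) ⟩
          (coeff u (suc k) 0 * ζ ^ suc k) * ζ⁻¹ ^ 0    ≈⟨ sym (coeff-act-diagonal ζ ζ⁻¹ u (suc k) 0) ⟩
          coeff (act diagonal ζ ζ⁻¹ u) (suc k) 0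
            ≈⟨ invariant diagonal ζ ζ⁻¹ (ζᵐ≈1 , ζ⁻¹ᵐ≈1 , ζᵐ≈1) (suc k) 0 ⟩
          coeff u (suc k) 0 ∎)
        lowY : ∀ k → k ℕ.< m → coeff u 0 k ≈ 0#
        lowY zero _ = u₀₀
        lowY (suc k) k<m = fixed-by-nontrivial (ζ-primitive k k<m) (begin
          coeff u 0 (suc k) * ζ ^ suc k                ≈⟨ *-congʳ (sym (*-identityʳ _)) ⟩
          (coeff u 0 (suc k) * ζ⁻¹ ^ 0) * ζ ^ suc k    ≈⟨ sym (coeff-act-diagonal ζ⁻¹ ζ u 0 (suc k)) ⟩
          coeff (act diagonal ζ⁻¹ ζ u) 0 (suc k)
            ≈⟨ invariant diagonal ζ⁻¹ ζ (ζ⁻¹ᵐ≈1 , ζᵐ≈1 , trans (*-comm ζ⁻¹ ζ) ζᵐ≈1) 0 (suc k) ⟩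
          coeff u 0 (suc k) ∎)
        symmetric : coeff u m 0 ≈ coeff u 0 m
        symmetric = begin
          coeff u m 0                                  ≈⟨ sym (invariant antidiagonal 1# 1# (1^ m , 1^ m , *-identityˡ 1#) m 0) ⟩
          coeff (act antidiagonal 1# 1# u) m 0         ≈⟨ coeff-act-antidiagonal 1# 1# u m 0 ⟩
          (coeff u 0 m * 1# ^ 0) * 1# ^ m              ≈⟨ trans (*-cong (*-identityʳ _) (1^ m)) (*-identityʳ _) ⟩
          coeff u 0 m ∎

    ideal-shape : ∀ {f} → InIdeal m f → IdealShape f
    ideal-shape (hus , generators , f≈) = shape-resp f≈ (sum-shape hus generators)
      where
        sum-shape : ∀ hus → All (λ hu → Invariant m (proj₂ hu) × (coeff (proj₂ hu) 0 0 ≈ 0#)) hus →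
          IdealShape (sumP (map (λ hu → proj₁ hu *P proj₂ hu) hus))
        sum-shape [] [] = shape-empty
        sum-shape ((h , u) ∷ hus) ((inv , u₀₀) ∷ gens) =
          shape-split (coeff-++ (h *P u) _) (shape-product h u (invariant-shape inv u₀₀)) (sum-shape hus gens)

    invariant-in-ideal : ∀ {u} → Invariant m u → coeff u 0 0 ≈ 0# → InIdeal m u
    invariant-in-ideal {u} invariant u₀₀ = ((mono 0 0 , u) ∷ []) , ((invariant , u₀₀) ∷ []) , λ i j → sym (begin
      coeff ((mono 0 0 *P u) +P []) i j   ≈⟨ trans (coeff-++ (mono 0 0 *P u) [] i j) (+-identityʳ _) ⟩
      coeff (mono 0 0 *P u) i j           ≈⟨ coeff-shift-inside 1# 0 0 u i j ⟩
      1# * coeff u i j                    ≈⟨ *-identityˡ _ ⟩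
      coeff u i j ∎)

    xy : Pol
    xy = (1# , 1 , 1) ∷ []

    powerSum : Pol
    powerSum = (1# , m , 0) ∷ (1# , 0 , m) ∷ []

    xy-scalar : ∀ {a b} → a * b ≈ 1# → 1# * a ^ 1 * b ^ 1 ≈ 1#
    xy-scalar {a} {b} ab≈1 = trans (*-cong (trans (*-identityˡ _) (*-identityʳ a)) (*-identityʳ b)) ab≈1

    xᵐ-scalar : ∀ {a} → a ^ m ≈ 1# → 1# * a ^ m * 1# ≈ 1#
    xᵐ-scalar aᵐ≈1 = trans (*-identityʳ _) (trans (*-identityˡ _) aᵐ≈1)

    yᵐ-scalar : ∀ {b} → b ^ m ≈ 1# → 1# * 1# * b ^ m ≈ 1#
    yᵐ-scalar bᵐ≈1 = trans (*-congʳ (*-identityˡ 1#)) (trans (*-identityˡ _) bᵐ≈1)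

    xy-invariant : Invariant m xy
    xy-invariant diagonal a b (_ , _ , ab≈1) = coeff-term-cong 1 1 [] (xy-scalar ab≈1)
    xy-invariant antidiagonal a b (_ , _ , ab≈1) = coeff-term-cong 1 1 [] (xy-scalar ab≈1)

    powerSum-invariant : Invariant m powerSum
    powerSum-invariant diagonal a b (aᵐ≈1 , bᵐ≈1 , _) i j = begin
      coeff (act diagonal a b powerSum) i j
        ≈⟨ coeff-++ ((1# * a ^ m * b ^ 0 , m , 0) ∷ []) _ i j ⟩
      coeff ((1# * a ^ m * b ^ 0 , m , 0) ∷ []) i j + coeff ((1# * a ^ 0 * b ^ m , 0 , m) ∷ []) i j
        ≈⟨ +-cong (coeff-term-cong m 0 [] (xᵐ-scalar aᵐ≈1) i j) (coeff-term-cong 0 m [] (yᵐ-scalar bᵐ≈1) i j) ⟩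
      coeff ((1# , m , 0) ∷ []) i j + coeff ((1# , 0 , m) ∷ []) i j
        ≈⟨ sym (coeff-++ ((1# , m , 0) ∷ []) _ i j) ⟩
      coeff powerSum i j ∎
    powerSum-invariant antidiagonal a b (aᵐ≈1 , bᵐ≈1 , _) i j = begin
      coeff (act antidiagonal a b powerSum) i j
        ≈⟨ coeff-++ ((1# * a ^ m * b ^ 0 , 0 , m) ∷ []) _ i j ⟩
      coeff ((1# * a ^ m * b ^ 0 , 0 , m) ∷ []) i j + coeff ((1# * a ^ 0 * b ^ m , m , 0) ∷ []) i j
        ≈⟨ +-cong (coeff-term-cong 0 m [] (xᵐ-scalar aᵐ≈1) i j) (coeff-term-cong m 0 [] (yᵐ-scalar bᵐ≈1) i j) ⟩
      coeff ((1# , 0 , m) ∷ []) i j + coeff ((1# , m , 0) ∷ []) i j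
        ≈⟨ +-comm _ _ ⟩
      coeff ((1# , m , 0) ∷ []) i j + coeff ((1# , 0 , m) ∷ []) i j
        ≈⟨ sym (coeff-++ ((1# , m , 0) ∷ []) _ i j) ⟩
      coeff powerSum i j ∎

    cancel-term : ∀ i k j l {x} → 1# * (fromℕ (falling i k) * (fromℕ (falling j l) * x)) ≈ 0# → x ≈ 0#
    cancel-term i k j l term≈0 = cancel-falling j l (cancel-falling i k (trans (sym (*-identityˡ _)) term≈0))

    multiple≡excess : ∀ t → suc (suc t) ℕ.* m ≡ suc (m' ℕ.+ t ℕ.* m) ℕ.+ m
    multiple≡excess t = equation m' t
      where equation : ∀ m' t → suc (suc t) ℕ.* suc m' ≡ suc (m' ℕ.+ t ℕ.* suc m') ℕ.+ suc m'
            equation = solve-∀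

    -- Harmonic polynomials have the profile without exceptions: test against xy and x^m + y^m.
    harmonic⇒profile : ∀ {g} → DW m g → Profile NoExceptions g
    harmonic⇒profile {g} harmonic = record
      { mixed = mixed ; balanced = balanced ; beyondX = λ n _ → beyondX n ; beyondY = λ n _ → beyondY n }
      where
        killedBy : ∀ {u} → Invariant m u → coeff u 0 0 ≈ 0# → ∀ i j → diffCoeff u (coeff g) i j ≈ 0#
        killedBy {u} invariant u₀₀ i j =
          trans (sym (coeff-applyDiff u g i j)) (harmonic u (invariant-in-ideal invariant u₀₀) i j)

        -- xy(∂) g = 0 removes the mixed terms.
        mixed : ∀ i j → coeff g (suc i) (suc j) ≈ 0#
        mixed i j = trans (coeff-cong g (ℕₚ.+-comm 1 i) (ℕₚ.+-comm 1 j))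
          (cancel-term i 1 j 1 (trans (sym (+-identityʳ _)) (killedBy xy-invariant refl i j)))

        -- (x^m + y^m)(∂) g = 0 at x^n, y^n and 1.
        beyondX : ∀ n → coeff g (suc n ℕ.+ m) 0 ≈ 0#
        beyondX n = cancel-term (suc n) m 0 0 (vanish-left (killedBy powerSum-invariant refl (suc n) 0)
          (trans (+-identityʳ _) (*-zero 1# (*-zero _ (*-zero _ (mixed (n ℕ.+ 0) m'))))))

        beyondY : ∀ n → coeff g 0 (suc n ℕ.+ m) ≈ 0#
        beyondY n = cancel-term 0 0 (suc n) m (trans (sym (+-identityʳ _)) (vanish-right (killedBy powerSum-invariant refl 0 (suc n))
          (*-zero 1# (*-zero _ (*-zero _ (mixed m' (n ℕ.+ 0)))))))

        balanced : ∀ t → coeff g (suc t ℕ.* m) 0 + coeff g 0 (suc t ℕ.* m) ≈ 0#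
        balanced zero = trans (+-cong (coeff-cong g m+0≡m ≡.refl) (coeff-cong g ≡.refl m+0≡m))
          (cancel-falling 0 m (begin
            F * (coeff g m 0 + coeff g 0 m)              ≈⟨ distribˡ F _ _ ⟩
            F * coeff g m 0 + F * coeff g 0 m            ≈⟨ sym (+-cong (trans (*-identityˡ _) (*-congˡ unit))
                                                                         (trans (+-identityʳ _) (trans (*-identityˡ _) unit))) ⟩
            diffCoeff powerSum (coeff g) 0 0             ≈⟨ killedBy powerSum-invariant refl 0 0 ⟩
            0# ∎))
          where
            F : Carrier
            F = fromℕ (falling 0 m)
            unit : ∀ {x} → fromℕ (falling 0 0) * x ≈ x
            unit = trans (*-congʳ (+-identityʳ 1#)) (*-identityˡ _)
        balanced (suc t) = trans (+-cong (coeff-cong g (multiple≡excess t) ≡.refl) (coeff-cong g ≡.refl (multiple≡excess t)))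
          (+-zero (beyondX _) (beyondY _))

    DW-basis : All (DW m) (basisW m)
    DW-basis = Allₚ.++⁺
      (Allₚ.map⁺ (Allₚ.applyUpTo⁺₁ id m (λ {k} k<m f inIdeal → shape-annihilates-xPower {f} (ideal-shape inIdeal) k k<m)))
      ((λ f inIdeal → shape-annihilates-top {f} (ideal-shape inIdeal)) ∷
       Allₚ.map⁺ (Allₚ.applyUpTo⁺₁ id m' (λ {k} k<m' f inIdeal →
         shape-annihilates-yPower {f} (ideal-shape inIdeal) (suc k) (s≤s k<m'))))

    basis-determined₀ : ∀ g → Profile NoExceptions g → VanishesOnPivots g (basisW m) → g ≈P 0P
    basis-determined₀ g pg vanish = basis-determined (λ _ → no λ ()) pg vanish (λ _ ())

    -- A profile polynomial is a combination of the harmonic basis, hence harmonic.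
    profile⇒harmonic : ∀ {g} → Profile NoExceptions g → DW m g
    profile⇒harmonic {g} pg f inIdeal with echelon-spans (Profile NoExceptions) (profile-closed _) (basisW m)
                                          basis-echelon basis-profile basis-determined₀ g pg
    ... | as , g≈ = annihilates-resp f g≈ (annihilates-lincomb f (basisW m) (All.map (λ harmonic → harmonic f inIdeal) DW-basis) as)

    harmonic-basis : IsBasis (DW m) (basisW m)
    harmonic-basis = echelon-basis (Profile NoExceptions) (DW m) (profile-closed NoExceptions) harmonic⇒profile
                       (basisW m) basis-echelon DW-basis basis-determined₀

    module Deformed (q : Carrier) where
      open import Algebra.Properties.Group +-group using (inverseʳ-unique)

      -- n is critical when q = -1/n, i.e. when 1 + q·n = 0.
      Critical : ℕ → Set ℓ
      Critical n = weight q n ≈ 0#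

      Regular : ℕ → Set (c ⊔ ℓ)
      Regular n = ∀ {x} → weight q n * x ≈ 0# → x ≈ 0#

      minusInv⇒critical : ∀ {n} → IsMinusInv q n → Critical n
      minusInv⇒critical qn≈-1 = trans (+-congˡ qn≈-1) (-‿inverseʳ 1#)

      critical⇒minusInv : ∀ {n} → Critical n → IsMinusInv q n
      critical⇒minusInv {n} critical = inverseʳ-unique 1# (q * fromℕ n) critical

      critical-annihilates : ∀ {n x} → Critical n → weight q n * x ≈ 0#
      critical-annihilates {x = x} critical = trans (*-congʳ critical) (zeroˡ x)

      noncritical-regular : ∀ {n} → ¬ Critical n → Regular n
      noncritical-regular ¬critical = cancel ¬critical

      -- Two different weights annihilate only 0: their difference is a nonzero multiple of q.
      weights-separate : ∀ {a b x} → a ℕ.< b → weight q a * x ≈ 0# → weight q b * x ≈ 0# → x ≈ 0#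
      weights-separate {a} {b} {x} a<b wa wb = begin
        x                                  ≈⟨ sym (weight-zero q x) ⟩
        weight q 0 * x                     ≈⟨ sym (+-identityʳ _) ⟩
        weight q 0 * x + 0#                ≈⟨ +-congˡ (sym (*-zero (fromℕ a) qx≈0)) ⟩
        weight q 0 * x + fromℕ a * (q * x) ≈⟨ sym (weight-shift q 0 a x) ⟩
        weight q a * x                     ≈⟨ wa ⟩
        0# ∎
        where
          d : ℕ
          d = b ℕ.∸ a
          a+d≡b : a ℕ.+ d ≡ b
          a+d≡b = ℕₚ.m+[n∸m]≡n (ℕₚ.<⇒≤ a<b)
          d≢0 : d ≢ 0
          d≢0 d≡0 = ℕₚ.<⇒≢ a<b (≡.trans (≡.sym (ℕₚ.+-identityʳ a))
                                        (≡.trans (≡.cong (a ℕ.+_) (≡.sym d≡0)) a+d≡b))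
          qx≈0 : q * x ≈ 0#
          qx≈0 = cancel-fromℕ d d≢0 (begin
            fromℕ d * (q * x)                  ≈⟨ sym (+-identityˡ _) ⟩
            0# + fromℕ d * (q * x)             ≈⟨ +-congʳ (sym wa) ⟩
            weight q a * x + fromℕ d * (q * x) ≈⟨ sym (weight-shift q a d x) ⟩
            weight q (a ℕ.+ d) * x             ≈⟨ ≡.subst (λ n → weight q n * x ≈ 0#) (≡.sym a+d≡b) wb ⟩
            0# ∎)

      regular-besides : ∀ {e n} → Critical e → n ≢ e → Regular n
      regular-besides {e} {n} critical n≢e wn with ℕₚ.<-cmp n e
      ... | tri< n<e _ _ = weights-separate n<e wn (critical-annihilates {e} critical)
      ... | tri≈ _ n≡e _ = contradiction n≡e n≢e
      ... | tri> _ _ e<n = weights-separate e<n (critical-annihilates {e} critical) wn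

      AxisConstraint : (ℕ → Carrier) → Set ℓ
      AxisConstraint a = ∀ t i → weight q (suc i) * a (suc i ℕ.+ suc t ℕ.* m) ≈ 0#

      -- Coefficient form of 𝒟_{W,q}.
      record QProfile (g : Pol) : Set ℓ where
        field
          mixed     : ∀ i j → coeff g (suc i) (suc j) ≈ 0#
          balanced  : ∀ t → coeff g (suc t ℕ.* m) 0 + coeff g 0 (suc t ℕ.* m) ≈ 0#
          weightedX : AxisConstraint (λ N → coeff g N 0)
          weightedY : AxisConstraint (λ N → coeff g 0 N)

      -- ∂x∂y kills the mixed terms; D_{q,k} at x^i, y^j and 1 gives the remaining conditions.
      deformed⇒qprofile : ∀ {g} → DWq m q g → QProfile g
      deformed⇒qprofile {g} (Dq≈0 , ∂x∂y≈0) = record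
        { mixed = mixed ; balanced = balanced ; weightedX = weightedX ; weightedY = weightedY }
        where
          mixed : ∀ i j → coeff g (suc i) (suc j) ≈ 0#
          mixed i j = cancel-fromℕ (suc j) (λ ()) (cancel-fromℕ (suc i) (λ ()) (trans (sym (coeff-∂x∂y g i j)) (∂x∂y≈0 i j)))

          equation : ∀ t i j → let k = suc t ℕ.* m in
            weight q i * (fromℕ (falling i k) * coeff g (i ℕ.+ k) j)
              + weight q j * (fromℕ (falling j k) * coeff g i (j ℕ.+ k)) ≈ 0#
          equation t i j = trans (sym (coeff-Dq q (suc t ℕ.* m) g i j)) (Dq≈0 t i j)

          weightedX : AxisConstraint (λ N → coeff g N 0)
          weightedX t i = cancel-falling (suc i) (suc t ℕ.* m) (trans (*-exchange _ _ _)
            (vanish-left (equation t (suc i) 0) (*-zero _ (*-zero _ (mixed i (m' ℕ.+ t ℕ.* m))))))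

          weightedY : AxisConstraint (λ N → coeff g 0 N)
          weightedY t j = cancel-falling (suc j) (suc t ℕ.* m) (trans (*-exchange _ _ _)
            (vanish-right (equation t 0 (suc j)) (*-zero _ (*-zero _ (mixed (m' ℕ.+ t ℕ.* m) j)))))

          balanced : ∀ t → coeff g (suc t ℕ.* m) 0 + coeff g 0 (suc t ℕ.* m) ≈ 0#
          balanced t = cancel-falling 0 (suc t ℕ.* m)
            (trans (distribˡ _ _ _) (trans (sym (+-cong (weight-zero q _) (weight-zero q _))) (equation t 0 0)))

      qprofile⇒deformed : ∀ {g} → QProfile g → DWq m q g
      qprofile⇒deformed {g} qg = (λ t i j → trans (coeff-Dq q (suc t ℕ.* m) g i j) (equation t i j)) ,
                                 (λ i j → trans (coeff-∂x∂y g i j) (*-zero _ (*-zero _ (mixed i j))))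
        where
          open QProfile qg
          equation : ∀ t i j → let k = suc t ℕ.* m in
            weight q i * (fromℕ (falling i k) * coeff g (i ℕ.+ k) j)
              + weight q j * (fromℕ (falling j k) * coeff g i (j ℕ.+ k)) ≈ 0#
          equation t zero zero = trans (+-cong (weight-zero q _) (weight-zero q _))
                                       (trans (sym (distribˡ _ _ _)) (*-zero _ (balanced t)))
          equation t (suc i) zero = +-zero (trans (*-exchange _ _ _) (*-zero _ (weightedX t i)))
                                           (*-zero _ (*-zero _ (mixed i _)))
          equation t zero (suc j) = +-zero (*-zero _ (*-zero _ (mixed _ j)))
                                           (trans (*-exchange _ _ _) (*-zero _ (weightedY t j)))
          equation t (suc i) (suc j) = +-zero (*-zero _ (*-zero _ (mixed _ j))) (*-zero _ (*-zero _ (mixed i _)))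

      first-multiple : ∀ n → suc n ℕ.+ suc 0 ℕ.* m ≡ suc n ℕ.+ m
      first-multiple n = ≡.cong (suc n ℕ.+_) m+0≡m

      second-multiple : ∀ s → suc s ℕ.+ suc 1 ℕ.* m ≡ suc (s ℕ.+ m) ℕ.+ m
      second-multiple s = equation m' s
        where equation : ∀ m' s → suc s ℕ.+ suc 1 ℕ.* suc m' ≡ suc (s ℕ.+ suc m') ℕ.+ suc m'
              equation = solve-∀

      later-multiple : ∀ i t → suc i ℕ.+ suc (suc t) ℕ.* m ≡ suc (i ℕ.+ suc t ℕ.* m) ℕ.+ m
      later-multiple i t = equation m' i t
        where equation : ∀ m' i t → suc i ℕ.+ suc (suc t) ℕ.* suc m' ≡ suc (i ℕ.+ suc t ℕ.* suc m') ℕ.+ suc m'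
              equation = solve-∀

      axis-first : ∀ a → AxisConstraint a → ∀ n → weight q (suc n) * a (suc n ℕ.+ m) ≈ 0#
      axis-first a constraint n = ≡.subst (λ N → weight q (suc n) * a N ≈ 0#) (first-multiple n) (constraint 0 n)

      axis-second : ∀ a → AxisConstraint a → ∀ s → weight q (suc s) * a (suc (s ℕ.+ m) ℕ.+ m) ≈ 0#
      axis-second a constraint s = ≡.subst (λ N → weight q (suc s) * a N ≈ 0#) (second-multiple s) (constraint 1 s)

      -- Beyond 2m an axis coefficient carries two different weights, so it vanishes; between m and 2m
      -- it carries the single weight 1 + q(N - m).
      axis-vanish : ∀ a → AxisConstraint a → ∀ n → (suc n ℕ.≤ m → Regular (suc n)) → a (suc n ℕ.+ m) ≈ 0#
      axis-vanish a constraint n regular with suc n ℕ.≤? m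
      ... | yes sn≤m = regular sn≤m (axis-first a constraint n)
      ... | no sn≰m = beyond (n ℕ.∸ m) n (ℕₚ.m∸n+n≡m (ℕₚ.≤-pred (ℕₚ.≰⇒> sn≰m)))
        where
          beyond : ∀ s n → s ℕ.+ m ≡ n → a (suc n ℕ.+ m) ≈ 0#
          beyond s _ ≡.refl = weights-separate (s≤s (ℕₚ.m<m+n s (s≤s z≤n)))
                                (axis-second a constraint s) (axis-first a constraint (s ℕ.+ m))

      Exceptional : (ℕ → Set) → Set ℓ
      Exceptional E = ∀ {e} → E e → e ℕ.≤ m × Critical e

      axis-constraint : ∀ {E} → (∀ e → Dec (E e)) → Exceptional E → ∀ a →
        (∀ n → ¬ E (suc n) → a (suc n ℕ.+ m) ≈ 0#) → AxisConstraint a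
      axis-constraint E? exceptional a beyond zero i with E? (suc i)
      ... | yes e = critical-annihilates {suc i} (proj₂ (exceptional e))
      ... | no ¬e = *-zero _ (≡.subst (λ N → a N ≈ 0#) (≡.sym (first-multiple i)) (beyond i ¬e))
      axis-constraint E? exceptional a beyond (suc t) i =
        *-zero _ (≡.subst (λ N → a N ≈ 0#) (≡.sym (later-multiple i t)) (beyond _ (λ e → too-large (proj₁ (exceptional e)))))
        where
          too-large : ¬ (suc (i ℕ.+ suc t ℕ.* m) ℕ.≤ m)
          too-large le = ℕₚ.<-irrefl ≡.refl (ℕₚ.<-≤-trans (s≤s (ℕₚ.≤-trans (multiple≥m t) (ℕₚ.m≤n+m _ i))) le)

      qprofile⇒profile : ∀ {E g} → (∀ n → ¬ E (suc n) → suc n ℕ.≤ m → Regular (suc n)) → QProfile g → Profile E g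
      qprofile⇒profile {g = g} regular qg = record
        { mixed    = mixed
        ; balanced = balanced
        ; beyondX  = λ n ¬e → axis-vanish (λ N → coeff g N 0) weightedX n (regular n ¬e)
        ; beyondY  = λ n ¬e → axis-vanish (λ N → coeff g 0 N) weightedY n (regular n ¬e)
        }
        where open QProfile qg

      profile⇒qprofile : ∀ {E g} → (∀ e → Dec (E e)) → Exceptional E → Profile E g → QProfile g
      profile⇒qprofile {g = g} E? exceptional pg = record
        { mixed     = mixed
        ; balanced  = balanced
        ; weightedX = axis-constraint E? exceptional (λ N → coeff g N 0) beyondX
        ; weightedY = axis-constraint E? exceptional (λ N → coeff g 0 N) beyondY
        }
        where open Profile pg

      deformed⇔harmonic : (∀ b → 1 ℕ.≤ b → b ℕ.≤ m → ¬ IsMinusInv q b) → ∀ g → DWq m q g ⇔ DW m g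
      deformed⇔harmonic notMinusInv g = mk⇔
        (λ deformed → profile⇒harmonic (qprofile⇒profile regular (deformed⇒qprofile deformed)))
        (λ harmonic → qprofile⇒deformed (profile⇒qprofile (λ _ → no λ ()) (λ ()) (harmonic⇒profile harmonic)))
        where
          regular : ∀ n → ¬ NoExceptions (suc n) → suc n ℕ.≤ m → Regular (suc n)
          regular n _ n<m = noncritical-regular {suc n}
            (λ critical → notMinusInv (suc n) (s≤s z≤n) n<m (critical⇒minusInv {suc n} critical))

      module Exception (e' : ℕ) (e≤m : suc e' ℕ.≤ m) (critical : Critical (suc e')) where
        Excess : ℕ → Set
        Excess n = n ≡ suc e'

        deformed⇒profile : ∀ {g} → DWq m q g → Profile Excess g
        deformed⇒profile deformed = qprofile⇒profile (λ n ¬e _ → regular-besides critical ¬e) (deformed⇒qprofile deformed)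

        profile⇒deformed : ∀ {g} → Profile Excess g → DWq m q g
        profile⇒deformed pg = qprofile⇒deformed (profile⇒qprofile (λ n → n ℕ.≟ suc e') (λ { ≡.refl → e≤m , critical }) pg)

        extended-basis : ∀ C → All (Profile Excess) C → Echelon C → All VanishesOnBox C →
          (∀ {g} → Profile Excess g → VanishesOnPivots g C →
             coeff g (suc e' ℕ.+ m) 0 ≈ 0# × coeff g 0 (suc e' ℕ.+ m) ≈ 0#) →
          IsBasis (DWq m q) (basisW m ++ C)
        extended-basis C profileC echelonC boxC detected =
          echelon-basis (Profile Excess) (DWq m q) (profile-closed Excess) deformed⇒profile (basisW m ++ C)
            (echelon-extension echelonC boxC)
            (Allₚ.++⁺ (All.map (λ pb → profile⇒deformed (profile-weaken (λ ()) pb)) basis-profile)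
                      (All.map profile⇒deformed profileC))
            determined
          where
            determined : ∀ g → Profile Excess g → VanishesOnPivots g (basisW m ++ C) → g ≈P 0P
            determined g pg vanish with Allₚ.++⁻ (basisW m) vanish
            ... | onBasis , onC = basis-determined (λ n → n ℕ.≟ suc e') pg onBasis (λ { _ ≡.refl → detected pg onC })

      offset-basis : ∀ e' → suc e' ℕ.< m → Critical (suc e') →
        IsBasis (DWq m q) (basisW m ++ mono (suc e' ℕ.+ m) 0 ∷ mono 0 (suc e' ℕ.+ m) ∷ [])
      offset-basis e' e<m critical =
        extended-basis (mono N 0 ∷ mono 0 N ∷ []) (xProfile ∷ yProfile ∷ []) echelonC (xBox ∷ yBox ∷ [])
                       (λ { _ (vx ∷ vy ∷ []) → vx , vy })
        where
          open Exception e' (ℕₚ.<⇒≤ e<m) critical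
          N : ℕ
          N = suc e' ℕ.+ m

          m<N : m ℕ.< N
          m<N = ℕₚ.m<n+m m (s≤s z≤n)

          -- N lies strictly between m and 2m, so it is not a multiple of m.
          not-multiple : ∀ t → suc t ℕ.* m ≢ N
          not-multiple t eq = short t (ℕₚ.+-cancelʳ-≡ m (t ℕ.* m) (suc e') (≡.trans (ℕₚ.+-comm (t ℕ.* m) m) eq))
            where
              short : ∀ t → t ℕ.* m ≢ suc e'
              short zero ()
              short (suc t) eq = ℕₚ.<⇒≱ e<m (ℕₚ.≤-trans (multiple≥m t) (ℕₚ.≤-reflexive eq))

          xProfile : Profile Excess (mono N 0)
          xProfile = record
            { mixed    = λ i j → mono-miss N 0 (suc i) (suc j) (λ ())
            ; balanced = λ t → +-zero (mono-miss N 0 (suc t ℕ.* m) 0 (λ (eq , _) → not-multiple t eq))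
                                      (mono-miss N 0 0 (suc t ℕ.* m) (λ ()))
            ; beyondX  = λ n ¬e → mono-miss N 0 (suc n ℕ.+ m) 0 (λ (eq , _) → ¬e (ℕₚ.+-cancelʳ-≡ m (suc n) (suc e') eq))
            ; beyondY  = λ n _ → mono-miss N 0 0 (suc n ℕ.+ m) (λ ())
            }

          yProfile : Profile Excess (mono 0 N)
          yProfile = record
            { mixed    = λ i j → mono-miss 0 N (suc i) (suc j) (λ ())
            ; balanced = λ t → +-zero (mono-miss 0 N (suc t ℕ.* m) 0 (λ ()))
                                      (mono-miss 0 N 0 (suc t ℕ.* m) (λ (_ , eq) → not-multiple t eq))
            ; beyondX  = λ n _ → mono-miss 0 N (suc n ℕ.+ m) 0 (λ ())
            ; beyondY  = λ n ¬e → mono-miss 0 N 0 (suc n ℕ.+ m) (λ (_ , eq) → ¬e (ℕₚ.+-cancelʳ-≡ m (suc n) (suc e') eq))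
            }

          echelonC : Echelon (mono N 0 ∷ mono 0 N ∷ [])
          echelonC = (mono-hit N 0 ∷ mono-hit 0 N ∷ []) , ((mono-miss 0 N N 0 (λ ()) ∷ []) ∷ [] ∷ [])

          xBox : VanishesOnBox (mono N 0)
          xBox i j i≤m _ = mono-miss N 0 i j (λ (eq , _) → ℕₚ.<⇒≱ m<N (≡.subst (ℕ._≤ m) eq i≤m))

          yBox : VanishesOnBox (mono 0 N)
          yBox i j _ j≤m = mono-miss 0 N i j (λ (_ , eq) → ℕₚ.<⇒≱ m<N (≡.subst (ℕ._≤ m) eq j≤m))

      top-basis : Critical m → IsBasis (DWq m q) (basisW m ++ axisDifference (m ℕ.+ m) ∷ [])
      top-basis critical =
        extended-basis (axisDifference M ∷ []) (dProfile ∷ []) ((difference-pivot (m' ℕ.+ m) ∷ []) , ([] ∷ []))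
                       (dBox ∷ []) detected
        where
          open Exception m' ℕₚ.≤-refl critical
          M : ℕ
          M = m ℕ.+ m

          beyond-m : ∀ {i} → i ℕ.≤ m → i ≢ M
          beyond-m i≤m eq = ℕₚ.<⇒≱ (ℕₚ.m<m+n m (s≤s z≤n)) (≡.subst (ℕ._≤ m) eq i≤m)

          dProfile : Profile Excess (axisDifference M)
          dProfile = record
            { mixed    = λ i j → difference-off M (suc i) (suc j) (λ ()) (λ ())
            ; balanced = λ t → difference-balanced M (m' ℕ.+ t ℕ.* m)
            ; beyondX  = λ n ¬e → difference-off M (suc n ℕ.+ m) 0 (λ (eq , _) → ¬e (ℕₚ.+-cancelʳ-≡ m (suc n) m eq)) (λ ())
            ; beyondY  = λ n ¬e → difference-off M 0 (suc n ℕ.+ m) (λ ()) (λ (_ , eq) → ¬e (ℕₚ.+-cancelʳ-≡ m (suc n) m eq))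
            }

          dBox : VanishesOnBox (axisDifference M)
          dBox i j i≤m j≤m = difference-off M i j (λ (eq , _) → beyond-m i≤m eq) (λ (_ , eq) → beyond-m j≤m eq)

          -- The balance at 2m turns the coefficient of x^(2m) into that of y^(2m).
          detected : ∀ {g} → Profile Excess g → VanishesOnPivots g (axisDifference M ∷ []) →
            coeff g M 0 ≈ 0# × coeff g 0 M ≈ 0#
          detected {g} pg (vx ∷ []) = vx , vanish-right balanced-2m vx
            where
              balanced-2m : coeff g M 0 + coeff g 0 M ≈ 0#
              balanced-2m = trans (+-cong (coeff-cong g (≡.sym 2m≡m+m) ≡.refl) (coeff-cong g ≡.refl (≡.sym 2m≡m+m)))
                                  (Profile.balanced pg 1)

open import Data.Nat using (_≤_; _<_; _+_; _*_)
open Poly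

mainTheorem4 : ∀ {c ℓ} (R : CommutativeRing c ℓ) →
    IsField R → CharZero R → (m : ℕ) → 1 ≤ m → HasPrimitiveRoot R m →
    (q : CommutativeRing.Carrier R) →
      ((∀ b → 1 ≤ b → b ≤ m → ¬ IsMinusInv R q b) →
          (∀ g → DWq R m q g ⇔ DW R m g) × IsBasis R (DW R m) (basisW R m))
    × (∀ b → 1 ≤ b → b < m → IsMinusInv R q b →
          IsBasis R (DWq R m q) (basisW R m ++ mono R (b + m) 0 ∷ mono R 0 (b + m) ∷ []))
    × (IsMinusInv R q m →
          IsBasis R (DWq R m q) (basisW R m ++ _-P_ R (mono R (2 * m) 0) (mono R 0 (2 * m)) ∷ []))
mainTheorem4 R isField charZero zero () root q
mainTheorem4 R isField charZero (suc m') _ root q =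
    (λ notMinusInv → deformed⇔harmonic notMinusInv , harmonic-basis)
  , (λ { zero ()
       ; (suc e') _ e<m minusInv → offset-basis e' e<m (minusInv⇒critical {suc e'} minusInv) })
  , (λ minusInv → ≡.subst (λ N → IsBasis R (DWq R m q) (basisW R m ++ axisDifference N ∷ [])) (≡.sym 2m≡m+m)
                          (top-basis (minusInv⇒critical {m} minusInv)))
  where
    open Dihedral R m'
    open WithField isField charZero root
    open Deformed q
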